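{- For all $n\ge1$, \[a_{\{0101,0112\}}(n)=a_{\{0102,0112\}}(n)=a_{\{0121,0112\}}(n)=a_{\{0102,0120\}}(n)=(n-1)2^{n-2}+1.\]
   Context: An ascent in an integer sequence $s_1\cdots s_m$ is an index $j$ with $s_j<s_{j+1}$; $\mathrm{asc}(s)$ is the number of ascents. An ascent sequence is a sequence $x_1\cdots x_n$ of nonnegative integers with $x_1=0$ and $x_i\le 1+\mathrm{asc}(x_1\cdots x_{i-1})$ for $i\ge2$. For a sequence $w$, $\mathrm{red}(w)$ replaces the $i$-th smallest distinct letter of $w$ by $i-1$. A pattern (e.g. $0101$, meaning the sequence $(0,1,0,1)$) is a sequence equal to its reduction. A sequence $x$ contains pattern $p=p_1\cdots p_k$ if there are indices $i_1<\cdots<i_k$ with $\mathrm{red}(x_{i_1}\cdots x_{i_k})=p$; otherwise it avoids $p$. For a set of patterns $P$, $\mathcal A_n(P)$ is the set of ascent sequences of length $n$ avoiding every pattern in $P$, and $a_P(n)=|\mathcal A_n(P)|$. -}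

module Defs where

open import Data.Nat using (ℕ; zero; suc; _+_; _≤_; _<?_)
open import Data.Bool using (if_then_else_)
open import Data.List using (List; []; _∷_; _++_; length; map; filter; upTo)
open import Data.List.Membership.DecPropositional (Data.Nat._≟_) using (_∈?_)
open import Data.List.Membership.Propositional using (_∈_)
open import Data.List.Relation.Unary.All using (All)
open import Data.List.Relation.Unary.Unique.Propositional using (Unique)
open import Data.List.Relation.Binary.Sublist.Propositional using (_⊆_)
open import Data.Product using (Σ; _×_)
open import Function.Bundles using (_⇔_)
open import Relation.Nullary using (¬_; does)
open import Relation.Binary.PropositionalEquality using (_≡_)

asc : List ℕ → ℕ
asc [] = 0
asc (x ∷ []) = 0
asc (x ∷ y ∷ r) = (if does (x <? y) then 1 else 0) + asc (y ∷ r)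

-- allowed upper bound for the next letter after prefix ys:
-- 0 for the empty prefix (x₁ = 0), otherwise 1 + asc ys
bound : List ℕ → ℕ
bound [] = 0
bound ys@(_ ∷ _) = suc (asc ys)

IsAscentSeq : List ℕ → Set
IsAscentSeq xs = ∀ ys z zs → xs ≡ ys ++ z ∷ zs → z ≤ bound ys

rank : List ℕ → ℕ → ℕ
rank w x = length (filter (λ v → v ∈? w) (upTo x))

red : List ℕ → List ℕ
red w = map (rank w) w

Contains : List ℕ → List ℕ → Set
Contains x p = Σ (List ℕ) λ s → s ⊆ x × red s ≡ p

Avoids : List ℕ → List (List ℕ) → Set
Avoids x P = All (λ p → ¬ Contains x p) P

InA : ℕ → List (List ℕ) → List ℕ → Set
InA n P x = IsAscentSeq x × length x ≡ n × Avoids x P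

HasCard : (List ℕ → Set) → ℕ → Set
HasCard S k = Σ (List (List ℕ)) λ L → Unique L × (∀ x → (x ∈ L) ⇔ S x) × length L ≡ k

aCount : List (List ℕ) → ℕ → ℕ → Set
aCount P n k = HasCard (InA n P) k

{-# OPTIONS --safe #-}
-- Each class is closed under deleting the last letter, so its words of length n + 1 are the
-- nodes at depth n of a generating tree rooted at 0 in which the children of x are the words
-- x z of the class. Appending z creates a new occurrence of a pattern only if that occurrence
-- ends in z, so whether x z is a child depends only on the three-letter subwords of x. In each
-- class a label of x (essentially its number of ascents and which of a few critical subwords
-- occur in it) determines the admissible letters z and the labels of the children. Counting
-- nodes by label, the number f d of nodes at depth d satisfies f (d + 1) = f d + g d, where g d
-- counts the depth-d descendants of the second child 0 1 of the root and 2 g d = (d + 2) 2^d;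
-- hence 2 f d = d 2^d + 2.

module Submission where

open import Defs
open import Data.Nat using (ℕ; zero; suc; _+_; _*_; _^_; _∸_; _≤_; _<_; _≤′_; ≤′-refl; ≤′-step; z≤n; s≤s; z<s; s<s; _<?_; _≤?_)
open import Data.Nat.Properties
open import Data.Nat.Tactic.RingSolver using (solve-∀)
open import Data.Bool using (if_then_else_)
open import Data.Unit using (⊤; tt)
open import Data.Empty using (⊥; ⊥-elim)
open import Data.Product using (∃-syntax; _×_; _,_; proj₁; proj₂; map₂)
open import Data.Sum as Sum using (_⊎_; inj₁; inj₂)
open import Data.List using (List; []; _∷_; _++_; length; map; filter; upTo)
open import Data.List.Base using (initLast; _∷ʳ′_)
open import Data.List.Properties using (upTo-∷ʳ; filter-++; filter-accept; filter-reject; length-++; length-map; ∷ʳ-injective; ∷ʳ-injectiveˡ; ∷ʳ-injectiveʳ; ++-assoc; map-++)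
open import Data.List.Membership.DecPropositional (Data.Nat._≟_) using (_∈?_)
open import Data.List.Membership.Propositional using (_∈_; _∉_)
open import Data.List.Membership.Propositional.Properties using (∈-++⁻; ∈-++⁺ˡ; ∈-++⁺ʳ; ∈-map⁺; ∈-map⁻)
open import Data.List.Relation.Unary.Any using (here; there)
open import Data.List.Relation.Unary.All as All using (All; []; _∷_)
open import Data.List.Relation.Unary.AllPairs using ([]; _∷_)
open import Data.List.Relation.Unary.Unique.Propositional using (Unique)
import Data.List.Relation.Unary.Unique.Propositional.Properties as Unique
open import Data.List.Relation.Binary.Sublist.Propositional using (_⊆_; []; _∷_; _∷ʳ_; ⊆-refl)
open import Data.List.Relation.Binary.Sublist.Propositional.Properties using (++⁺ʳ; ++⁺; ∷ˡ⁻; Any-resp-⊆; length-mono-≤)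
open import Function.Base using (_∘_; _∋_)
open import Function.Bundles using (_⇔_; mk⇔; Equivalence)
open import Relation.Nullary using (¬_; yes; no; does)
open import Relation.Nullary.Decidable using (dec-true; dec-false)
open import Relation.Binary.PropositionalEquality
open import Relation.Binary.Definitions using (tri<; tri≈; tri>)

-- Ranks and reductions of four-letter words

rank-suc : ∀ w x → rank w (suc x) ≡ rank w x + length (filter (_∈? w) (x ∷ []))
rank-suc w x = begin
    rank w (suc x)
  ≡⟨ cong (length ∘ filter (_∈? w)) (sym (upTo-∷ʳ x)) ⟩
    length (filter (_∈? w) (upTo x ++ x ∷ []))
  ≡⟨ cong length (filter-++ (_∈? w) (upTo x) (x ∷ [])) ⟩
    length (filter (_∈? w) (upTo x) ++ filter (_∈? w) (x ∷ []))
  ≡⟨ length-++ (filter (_∈? w) (upTo x)) ⟩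
    rank w x + length (filter (_∈? w) (x ∷ []))
  ∎
  where open ≡-Reasoning

rank-suc-∈ : ∀ {w x} → x ∈ w → rank w (suc x) ≡ suc (rank w x)
rank-suc-∈ {w} {x} x∈w = begin
    rank w (suc x)                               ≡⟨ rank-suc w x ⟩
    rank w x + length (filter (_∈? w) (x ∷ [])) ≡⟨ cong (λ l → rank w x + length l) (filter-accept (_∈? w) x∈w) ⟩
    rank w x + 1                                 ≡⟨ +-comm (rank w x) 1 ⟩
    suc (rank w x)                               ∎
  where open ≡-Reasoning

rank-suc-∉ : ∀ {w x} → x ∉ w → rank w (suc x) ≡ rank w x
rank-suc-∉ {w} {x} x∉w = begin
    rank w (suc x)                               ≡⟨ rank-suc w x ⟩
    rank w x + length (filter (_∈? w) (x ∷ [])) ≡⟨ cong (λ l → rank w x + length l) (filter-reject (_∈? w) x∉w) ⟩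
    rank w x + 0                                 ≡⟨ +-identityʳ (rank w x) ⟩
    rank w x                                     ∎
  where open ≡-Reasoning

rank-mono′ : ∀ w {u v} → u ≤′ v → rank w u ≤ rank w v
rank-mono′ w ≤′-refl = ≤-refl
rank-mono′ w {v = suc v} (≤′-step u≤v) =
  ≤-trans (rank-mono′ w u≤v) (subst (rank w v ≤_) (sym (rank-suc w v)) (m≤m+n _ _))

rank-mono : ∀ w {u v} → u ≤ v → rank w u ≤ rank w v
rank-mono w = rank-mono′ w ∘ ≤⇒≤′

rank-< : ∀ {w u v} → u ∈ w → u < v → rank w u < rank w v
rank-< {w} u∈w u<v = subst (_≤ _) (rank-suc-∈ u∈w) (rank-mono w u<v)

rank-<⁻ : ∀ {w u v} → rank w u < rank w v → u < v
rank-<⁻ {w} {u} {v} ru<rv with u <? v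
... | yes u<v = u<v
... | no u≮v = ⊥-elim (<⇒≱ ru<rv (rank-mono w (≮⇒≥ u≮v)))

rank-injective : ∀ {w u v} → u ∈ w → v ∈ w → rank w u ≡ rank w v → u ≡ v
rank-injective {w} {u} {v} u∈w v∈w ru≡rv with <-cmp u v
... | tri< u<v _ _ = ⊥-elim (<⇒≢ (rank-< u∈w u<v) ru≡rv)
... | tri≈ _ u≡v _ = u≡v
... | tri> _ _ v<u = ⊥-elim (<⇒≢ (rank-< v∈w v<u) (sym ru≡rv))

rank-gap′ : ∀ {w u v} → All (λ y → y < u ⊎ v ≤ y) w → u ≤′ v → rank w v ≡ rank w u
rank-gap′ gap ≤′-refl = refl
rank-gap′ {w} {u} {suc v} gap (≤′-step u≤v) =
  trans (rank-suc-∉ v∉w) (rank-gap′ (All.map (Sum.map₂ (≤-trans (n≤1+n v))) gap) u≤v)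
  where
  v∉w : v ∉ w
  v∉w v∈w with All.lookup gap v∈w
  ... | inj₁ v<u = <⇒≱ v<u (≤′⇒≤ u≤v)
  ... | inj₂ 1+v≤v = 1+n≰n 1+v≤v

rank-gap : ∀ {w u v} → All (λ y → y < u ⊎ v ≤ y) w → u ≤ v → rank w v ≡ rank w u
rank-gap gap = rank-gap′ gap ∘ ≤⇒≤′

rank-minimum : ∀ {w} u → All (u ≤_) w → rank w u ≡ 0
rank-minimum u u≤w = rank-gap (All.map inj₂ u≤w) z≤n

rank-next : ∀ {w a} b → a ∈ w → a < b → All (λ y → y < suc a ⊎ b ≤ y) w → rank w b ≡ suc (rank w a)
rank-next b a∈w a<b gap = trans (rank-gap gap a<b) (rank-suc-∈ a∈w)

Characterises : List ℕ → (ℕ → ℕ → ℕ → ℕ → Set) → Set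
Characterises p C = ∀ a b c d → red (a ∷ b ∷ c ∷ d ∷ []) ≡ p ⇔ C a b c d

private
  variable
    a b c d i j k l : ℕ

  ∈₁ : a ∈ a ∷ b ∷ c ∷ d ∷ []
  ∈₁ = here refl
  ∈₂ : b ∈ a ∷ b ∷ c ∷ d ∷ []
  ∈₂ = there (here refl)
  ∈₃ : c ∈ a ∷ b ∷ c ∷ d ∷ []
  ∈₃ = there (there (here refl))
  ∈₄ : d ∈ a ∷ b ∷ c ∷ d ∷ []
  ∈₄ = there (there (there (here refl)))

  ∷₄-injective : ∀ {m n o p} → (List ℕ ∋ m ∷ n ∷ o ∷ p ∷ []) ≡ i ∷ j ∷ k ∷ l ∷ [] → m ≡ i × n ≡ j × o ≡ k × p ≡ l
  ∷₄-injective refl = refl , refl , refl , refl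

  rank≡⇒< : ∀ {w u v} → rank w u ≡ i → rank w v ≡ j → i < j → u < v
  rank≡⇒< refl refl = rank-<⁻

  rank≡⇒≡ : ∀ {w u v} → rank w u ≡ i → rank w v ≡ i → u ∈ w → v ∈ w → u ≡ v
  rank≡⇒≡ ru rv u∈w v∈w = rank-injective u∈w v∈w (trans ru (sym rv))

red≡0101⇔ : Characterises (0 ∷ 1 ∷ 0 ∷ 1 ∷ []) (λ a b c d → a < b × c ≡ a × d ≡ b)
red≡0101⇔ _ _ _ _ = mk⇔ to from
  where
  to : red (a ∷ b ∷ c ∷ d ∷ []) ≡ 0 ∷ 1 ∷ 0 ∷ 1 ∷ [] → a < b × c ≡ a × d ≡ b
  to e with ra , rb , rc , rd ← ∷₄-injective e =
    rank≡⇒< ra rb z<s , rank≡⇒≡ rc ra ∈₃ ∈₁ , rank≡⇒≡ rd rb ∈₄ ∈₂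
  from : a < b × c ≡ a × d ≡ b → red (a ∷ b ∷ c ∷ d ∷ []) ≡ 0 ∷ 1 ∷ 0 ∷ 1 ∷ []
  from {a} {b} (a<b , refl , refl) = cong₂ _∷_ ra (cong₂ _∷_ rb (cong₂ _∷_ ra (cong₂ _∷_ rb refl)))
    where
    ra = rank-minimum a (≤-refl ∷ <⇒≤ a<b ∷ ≤-refl ∷ <⇒≤ a<b ∷ [])
    rb = trans (rank-next b ∈₁ a<b (inj₁ ≤-refl ∷ inj₂ ≤-refl ∷ inj₁ ≤-refl ∷ inj₂ ≤-refl ∷ [])) (cong suc ra)

red≡0112⇔ : Characterises (0 ∷ 1 ∷ 1 ∷ 2 ∷ []) (λ a b c d → a < b × c ≡ b × b < d)
red≡0112⇔ _ _ _ _ = mk⇔ to from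
  where
  to : red (a ∷ b ∷ c ∷ d ∷ []) ≡ 0 ∷ 1 ∷ 1 ∷ 2 ∷ [] → a < b × c ≡ b × b < d
  to e with ra , rb , rc , rd ← ∷₄-injective e =
    rank≡⇒< ra rb z<s , rank≡⇒≡ rc rb ∈₃ ∈₂ , rank≡⇒< rb rd (s<s z<s)
  from : a < b × c ≡ b × b < d → red (a ∷ b ∷ c ∷ d ∷ []) ≡ 0 ∷ 1 ∷ 1 ∷ 2 ∷ []
  from {a} {b} {d = d} (a<b , refl , b<d) = cong₂ _∷_ ra (cong₂ _∷_ rb (cong₂ _∷_ rb (cong₂ _∷_ rd refl)))
    where
    a<d = <-trans a<b b<d
    ra = rank-minimum a (≤-refl ∷ <⇒≤ a<b ∷ <⇒≤ a<b ∷ <⇒≤ a<d ∷ [])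
    rb = trans (rank-next b ∈₁ a<b (inj₁ ≤-refl ∷ inj₂ ≤-refl ∷ inj₂ ≤-refl ∷ inj₂ (<⇒≤ b<d) ∷ [])) (cong suc ra)
    rd = trans (rank-next d ∈₂ b<d (inj₁ (m<n⇒m<1+n a<b) ∷ inj₁ ≤-refl ∷ inj₁ ≤-refl ∷ inj₂ ≤-refl ∷ [])) (cong suc rb)

red≡0102⇔ : Characterises (0 ∷ 1 ∷ 0 ∷ 2 ∷ []) (λ a b c d → a < b × c ≡ a × b < d)
red≡0102⇔ _ _ _ _ = mk⇔ to from
  where
  to : red (a ∷ b ∷ c ∷ d ∷ []) ≡ 0 ∷ 1 ∷ 0 ∷ 2 ∷ [] → a < b × c ≡ a × b < d
  to e with ra , rb , rc , rd ← ∷₄-injective e =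
    rank≡⇒< ra rb z<s , rank≡⇒≡ rc ra ∈₃ ∈₁ , rank≡⇒< rb rd (s<s z<s)
  from : a < b × c ≡ a × b < d → red (a ∷ b ∷ c ∷ d ∷ []) ≡ 0 ∷ 1 ∷ 0 ∷ 2 ∷ []
  from {a} {b} {d = d} (a<b , refl , b<d) = cong₂ _∷_ ra (cong₂ _∷_ rb (cong₂ _∷_ ra (cong₂ _∷_ rd refl)))
    where
    a<d = <-trans a<b b<d
    ra = rank-minimum a (≤-refl ∷ <⇒≤ a<b ∷ ≤-refl ∷ <⇒≤ a<d ∷ [])
    rb = trans (rank-next b ∈₁ a<b (inj₁ ≤-refl ∷ inj₂ ≤-refl ∷ inj₁ ≤-refl ∷ inj₂ (<⇒≤ b<d) ∷ [])) (cong suc ra)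
    rd = trans (rank-next d ∈₂ b<d (inj₁ (m<n⇒m<1+n a<b) ∷ inj₁ ≤-refl ∷ inj₁ (m<n⇒m<1+n a<b) ∷ inj₂ ≤-refl ∷ [])) (cong suc rb)

red≡0121⇔ : Characterises (0 ∷ 1 ∷ 2 ∷ 1 ∷ []) (λ a b c d → a < b × b < c × d ≡ b)
red≡0121⇔ _ _ _ _ = mk⇔ to from
  where
  to : red (a ∷ b ∷ c ∷ d ∷ []) ≡ 0 ∷ 1 ∷ 2 ∷ 1 ∷ [] → a < b × b < c × d ≡ b
  to e with ra , rb , rc , rd ← ∷₄-injective e =
    rank≡⇒< ra rb z<s , rank≡⇒< rb rc (s<s z<s) , rank≡⇒≡ rd rb ∈₄ ∈₂
  from : a < b × b < c × d ≡ b → red (a ∷ b ∷ c ∷ d ∷ []) ≡ 0 ∷ 1 ∷ 2 ∷ 1 ∷ []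
  from {a} {b} {c} (a<b , b<c , refl) = cong₂ _∷_ ra (cong₂ _∷_ rb (cong₂ _∷_ rc (cong₂ _∷_ rb refl)))
    where
    a<c = <-trans a<b b<c
    ra = rank-minimum a (≤-refl ∷ <⇒≤ a<b ∷ <⇒≤ a<c ∷ <⇒≤ a<b ∷ [])
    rb = trans (rank-next b ∈₁ a<b (inj₁ ≤-refl ∷ inj₂ ≤-refl ∷ inj₂ (<⇒≤ b<c) ∷ inj₂ ≤-refl ∷ [])) (cong suc ra)
    rc = trans (rank-next c ∈₂ b<c (inj₁ (m<n⇒m<1+n a<b) ∷ inj₁ ≤-refl ∷ inj₂ ≤-refl ∷ inj₁ ≤-refl ∷ [])) (cong suc rb)

red≡0120⇔ : Characterises (0 ∷ 1 ∷ 2 ∷ 0 ∷ []) (λ a b c d → a < b × b < c × d ≡ a)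
red≡0120⇔ _ _ _ _ = mk⇔ to from
  where
  to : red (a ∷ b ∷ c ∷ d ∷ []) ≡ 0 ∷ 1 ∷ 2 ∷ 0 ∷ [] → a < b × b < c × d ≡ a
  to e with ra , rb , rc , rd ← ∷₄-injective e =
    rank≡⇒< ra rb z<s , rank≡⇒< rb rc (s<s z<s) , rank≡⇒≡ rd ra ∈₄ ∈₁
  from : a < b × b < c × d ≡ a → red (a ∷ b ∷ c ∷ d ∷ []) ≡ 0 ∷ 1 ∷ 2 ∷ 0 ∷ []
  from {a} {b} {c} (a<b , b<c , refl) = cong₂ _∷_ ra (cong₂ _∷_ rb (cong₂ _∷_ rc (cong₂ _∷_ ra refl)))
    where
    a<c = <-trans a<b b<c
    ra = rank-minimum a (≤-refl ∷ <⇒≤ a<b ∷ <⇒≤ a<c ∷ ≤-refl ∷ [])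
    rb = trans (rank-next b ∈₁ a<b (inj₁ ≤-refl ∷ inj₂ ≤-refl ∷ inj₂ (<⇒≤ b<c) ∷ inj₁ ≤-refl ∷ [])) (cong suc ra)
    rc = trans (rank-next c ∈₂ b<c (inj₁ (m<n⇒m<1+n a<b) ∷ inj₁ ≤-refl ∷ inj₂ ≤-refl ∷ inj₁ (m<n⇒m<1+n a<b) ∷ [])) (cong suc rb)

-- Appending a letter

⊆-∷ʳ-cases : ∀ {s : List ℕ} x z → s ⊆ x ++ z ∷ [] → s ⊆ x ⊎ ∃[ s′ ] (s ≡ s′ ++ z ∷ [] × s′ ⊆ x)
⊆-∷ʳ-cases [] z (.z ∷ʳ []) = inj₁ []
⊆-∷ʳ-cases [] z (refl ∷ []) = inj₂ ([] , refl , [])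
⊆-∷ʳ-cases (y ∷ x) z (.y ∷ʳ sub) with ⊆-∷ʳ-cases x z sub
... | inj₁ s⊆x = inj₁ (y ∷ʳ s⊆x)
... | inj₂ (s′ , refl , s′⊆x) = inj₂ (s′ , refl , y ∷ʳ s′⊆x)
⊆-∷ʳ-cases (y ∷ x) z (refl ∷ sub) with ⊆-∷ʳ-cases x z sub
... | inj₁ s⊆x = inj₁ (refl ∷ s⊆x)
... | inj₂ (s′ , refl , s′⊆x) = inj₂ (y ∷ s′ , refl , refl ∷ s′⊆x)

⊆-∷ʳ⁻ : ∀ s {w : ℕ} x z → s ++ w ∷ [] ⊆ x ++ z ∷ [] → s ++ w ∷ [] ⊆ x ⊎ (s ⊆ x × w ≡ z)
⊆-∷ʳ⁻ s x z sub with ⊆-∷ʳ-cases x z sub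
... | inj₁ sw⊆x = inj₁ sw⊆x
... | inj₂ (s′ , e , s′⊆x) with refl , refl ← ∷ʳ-injective s s′ e = inj₂ (s′⊆x , refl)

length-∷ʳ : ∀ (x : List ℕ) z → length (x ++ z ∷ []) ≡ suc (length x)
length-∷ʳ x z = trans (length-++ x) (+-comm (length x) 1)

∈-∷ʳ⁻ : ∀ {v : ℕ} x z → v ∈ x ++ z ∷ [] → v ∈ x ⊎ v ≡ z
∈-∷ʳ⁻ x z v∈xz with ∈-++⁻ x v∈xz
... | inj₁ v∈x = inj₁ v∈x
... | inj₂ (here v≡z) = inj₂ v≡z

Contains-++ : ∀ {x p} y → Contains x p → Contains (x ++ y) p
Contains-++ y (s , s⊆x , red≡p) = s , ++⁺ʳ y s⊆x , red≡p

Avoids-++⁻ : ∀ {x P} y → Avoids (x ++ y) P → Avoids x P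
Avoids-++⁻ y = All.map (λ ¬xy → ¬xy ∘ Contains-++ y)

¬Contains-shorter : ∀ {x p} → length x < length p → ¬ Contains x p
¬Contains-shorter {x} x<p (s , s⊆x , refl) =
  <⇒≱ x<p (≤-trans (≤-reflexive (length-map (rank s) s)) (length-mono-≤ s⊆x))

Avoids-[0] : ∀ {P} → All (λ p → 1 < length p) P → Avoids (0 ∷ []) P
Avoids-[0] = All.map ¬Contains-shorter

module _ {p₁ p₂ p₃ p₄ C} (red≡p⇔C : Characterises (p₁ ∷ p₂ ∷ p₃ ∷ p₄ ∷ []) C) where

  -- An occurrence in x ++ z ∷ [] that is not one in x uses z as its last letter.
  ¬Contains-∷ʳ : ∀ {x z} → ¬ Contains x (p₁ ∷ p₂ ∷ p₃ ∷ p₄ ∷ []) →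
                 (∀ {a b c} → a ∷ b ∷ c ∷ [] ⊆ x → ¬ C a b c z) →
                 ¬ Contains (x ++ z ∷ []) (p₁ ∷ p₂ ∷ p₃ ∷ p₄ ∷ [])
  ¬Contains-∷ʳ {x} {z} ¬old ¬new (a ∷ b ∷ c ∷ d ∷ [] , sub , red≡p) with ⊆-∷ʳ⁻ (a ∷ b ∷ c ∷ []) x z sub
  ... | inj₁ old = ¬old (_ , old , red≡p)
  ... | inj₂ (abc⊆x , refl) = ¬new abc⊆x (Equivalence.to (red≡p⇔C _ _ _ _) red≡p)

  ¬Contains-∷ʳ⁻ : ∀ {x z a b c} → ¬ Contains (x ++ z ∷ []) (p₁ ∷ p₂ ∷ p₃ ∷ p₄ ∷ []) →
                  a ∷ b ∷ c ∷ [] ⊆ x → ¬ C a b c z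
  ¬Contains-∷ʳ⁻ ¬xz abc⊆x cond = ¬xz (_ , ++⁺ abc⊆x ⊆-refl , Equivalence.from (red≡p⇔C _ _ _ _) cond)

IsAscentSeq-[0] : IsAscentSeq (0 ∷ [])
IsAscentSeq-[0] [] z [] refl = z≤n
IsAscentSeq-[0] (_ ∷ []) _ _ ()
IsAscentSeq-[0] (_ ∷ _ ∷ _) _ _ ()

IsAscentSeq-∷ʳ : ∀ {x z} → IsAscentSeq x → z ≤ bound x → IsAscentSeq (x ++ z ∷ [])
IsAscentSeq-∷ʳ {x} {z} asc-x z≤ ys y zs e with initLast zs
... | [] with refl , refl ← ∷ʳ-injective x ys e = z≤
... | zs′ ∷ʳ′ _ = asc-x ys y zs′ (∷ʳ-injectiveˡ x (ys ++ y ∷ zs′) (trans e (sym (++-assoc ys (y ∷ zs′) _))))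

IsAscentSeq-∷ʳ⁻ : ∀ {x z} → IsAscentSeq (x ++ z ∷ []) → IsAscentSeq x × z ≤ bound x
IsAscentSeq-∷ʳ⁻ {x} {z} asc-xz =
  (λ ys y zs e → asc-xz ys y (zs ++ z ∷ []) (trans (cong (_++ z ∷ []) e) (++-assoc ys (y ∷ zs) (z ∷ []))))
  , asc-xz x z [] refl

bound-∷ʳ : ∀ x l → bound (x ++ l ∷ []) ≡ suc (asc (x ++ l ∷ []))
bound-∷ʳ [] l = refl
bound-∷ʳ (_ ∷ _) l = refl

asc-∷ʳ-≤ : ∀ x {l z} → z ≤ l → asc ((x ++ l ∷ []) ++ z ∷ []) ≡ asc (x ++ l ∷ [])
asc-∷ʳ-≤ [] {l} {z} z≤l = cong (λ b → (if b then 1 else 0) + 0) (dec-false (l <? z) (≤⇒≯ z≤l))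
asc-∷ʳ-≤ (a ∷ []) {l} z≤l = cong ((if does (a <? l) then 1 else 0) +_) (asc-∷ʳ-≤ [] z≤l)
asc-∷ʳ-≤ (a ∷ b ∷ x) z≤l = cong ((if does (a <? b) then 1 else 0) +_) (asc-∷ʳ-≤ (b ∷ x) z≤l)

asc-∷ʳ-< : ∀ x {l z} → l < z → asc ((x ++ l ∷ []) ++ z ∷ []) ≡ suc (asc (x ++ l ∷ []))
asc-∷ʳ-< [] {l} {z} l<z = cong (λ b → (if b then 1 else 0) + 0) (dec-true (l <? z) l<z)
asc-∷ʳ-< (a ∷ []) {l} l<z = trans (cong ((if does (a <? l) then 1 else 0) +_) (asc-∷ʳ-< [] l<z)) (+-suc _ _)
asc-∷ʳ-< (a ∷ b ∷ x) l<z = trans (cong ((if does (a <? b) then 1 else 0) +_) (asc-∷ʳ-< (b ∷ x) l<z)) (+-suc _ _)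

asc-∷ʳ-mono : ∀ x z → asc x ≤ asc (x ++ z ∷ [])
asc-∷ʳ-mono [] z = z≤n
asc-∷ʳ-mono (a ∷ []) z = z≤n
asc-∷ʳ-mono (a ∷ b ∷ x) z = +-monoʳ-≤ (if does (a <? b) then 1 else 0) (asc-∷ʳ-mono (b ∷ x) z)

-- Generating trees

module GeneratingTree (P : List (List ℕ)) {S : Set} (s₀ : S) (children : S → List (ℕ × S)) where

  data Reach : List ℕ → S → Set where
    root : Reach (0 ∷ []) s₀
    grow : ∀ {x s z t} → Reach x s → (z , t) ∈ children s → Reach (x ++ z ∷ []) t

  Reach-∷ʳ : ∀ {x s} → Reach x s → ∃[ x′ ] ∃[ l ] x ≡ x′ ++ l ∷ []
  Reach-∷ʳ root = [] , 0 , refl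
  Reach-∷ʳ (grow {x} {z = z} _ _) = x , z , refl

  Reach-0 : ∀ {x s} → Reach x s → 0 ∷ [] ⊆ x
  Reach-0 root = ⊆-refl
  Reach-0 (grow R _) = ++⁺ʳ _ (Reach-0 R)

  Reach-bound : ∀ {x s} → Reach x s → bound x ≡ suc (asc x)
  Reach-bound R with x′ , l , refl ← Reach-∷ʳ R = bound-∷ʳ x′ l

  Reach-letters-≤ : (h : S → ℕ) → (∀ {s z t} → (z , t) ∈ children s → h s ≤ h t × z ≤ h t) →
                    ∀ {x s v} → Reach x s → v ∈ x → v ≤ h s
  Reach-letters-≤ h h-mono root (here refl) = z≤n
  Reach-letters-≤ h h-mono (grow {x} {z = z} R c) v∈xz with ∈-∷ʳ⁻ x z v∈xz
  ... | inj₁ v∈x = ≤-trans (Reach-letters-≤ h h-mono R v∈x) (proj₁ (h-mono c))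
  ... | inj₂ refl = proj₂ (h-mono c)

  mutual
    nodes : S → ℕ → ℕ
    nodes s zero = 1
    nodes s (suc d) = nodes* (children s) d

    nodes* : List (ℕ × S) → ℕ → ℕ
    nodes* [] d = 0
    nodes* ((_ , t) ∷ cs) d = nodes t d + nodes* cs d

  Node : Set
  Node = List ℕ × S

  graft : List ℕ → List (ℕ × S) → List Node
  graft x = map (λ (z , t) → x ++ z ∷ [] , t)

  expand : List Node → List Node
  expand [] = []
  expand ((x , s) ∷ l) = graft x (children s) ++ expand l

  level : ℕ → List Node
  level zero = (0 ∷ [] , s₀) ∷ []
  level (suc n) = expand (level n)

  weight : List Node → ℕ → ℕ
  weight [] d = 0
  weight ((_ , s) ∷ l) d = nodes s d + weight l d

  weight-++ : ∀ l m d → weight (l ++ m) d ≡ weight l d + weight m d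
  weight-++ [] m d = refl
  weight-++ ((_ , s) ∷ l) m d = trans (cong (nodes s d +_) (weight-++ l m d)) (sym (+-assoc (nodes s d) _ _))

  weight-graft : ∀ x cs d → weight (graft x cs) d ≡ nodes* cs d
  weight-graft x [] d = refl
  weight-graft x ((_ , t) ∷ cs) d = cong (nodes t d +_) (weight-graft x cs d)

  weight-expand : ∀ l d → weight (expand l) d ≡ weight l (suc d)
  weight-expand [] d = refl
  weight-expand ((x , s) ∷ l) d = begin
      weight (graft x (children s) ++ expand l) d
    ≡⟨ weight-++ (graft x (children s)) (expand l) d ⟩
      weight (graft x (children s)) d + weight (expand l) d
    ≡⟨ cong₂ _+_ (weight-graft x (children s) d) (weight-expand l d) ⟩
      nodes s (suc d) + weight l (suc d)
    ∎
    where open ≡-Reasoning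

  weight-level : ∀ n d → weight (level n) d ≡ nodes s₀ (n + d)
  weight-level zero d = +-identityʳ (nodes s₀ d)
  weight-level (suc n) d = begin
      weight (expand (level n)) d  ≡⟨ weight-expand (level n) d ⟩
      weight (level n) (suc d)     ≡⟨ weight-level n (suc d) ⟩
      nodes s₀ (n + suc d)         ≡⟨ cong (nodes s₀) (+-suc n d) ⟩
      nodes s₀ (suc n + d)         ∎
    where open ≡-Reasoning

  length≡weight : ∀ l → length l ≡ weight l 0
  length≡weight [] = refl
  length≡weight (_ ∷ l) = cong suc (length≡weight l)

  length-level : ∀ n → length (map proj₁ (level n)) ≡ nodes s₀ n
  length-level n = begin
      length (map proj₁ (level n))  ≡⟨ length-map proj₁ (level n) ⟩
      length (level n)              ≡⟨ length≡weight (level n) ⟩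
      weight (level n) 0            ≡⟨ weight-level n 0 ⟩
      nodes s₀ (n + 0)              ≡⟨ cong (nodes s₀) (+-identityʳ n) ⟩
      nodes s₀ n                    ∎
    where open ≡-Reasoning

  map-proj₁-graft : ∀ x cs → map proj₁ (graft x cs) ≡ map (λ z → x ++ z ∷ []) (map proj₁ cs)
  map-proj₁-graft x [] = refl
  map-proj₁-graft x (_ ∷ cs) = cong (_ ∷_) (map-proj₁-graft x cs)

  expand⁻ : ∀ {y t} l → (y , t) ∈ expand l →
            ∃[ x ] ∃[ s ] ∃[ z ] (x , s) ∈ l × y ≡ x ++ z ∷ [] × (z , t) ∈ children s
  expand⁻ ((x , s) ∷ l) yt∈ with ∈-++⁻ (graft x (children s)) yt∈
  ... | inj₁ yt∈graft with (z , t) , zt∈ , refl ← ∈-map⁻ _ yt∈graft = x , s , z , here refl , refl , zt∈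
  ... | inj₂ yt∈expand with x′ , s′ , z , xs∈ , e , zt∈ ← expand⁻ l yt∈expand = x′ , s′ , z , there xs∈ , e , zt∈

  expand⁺ : ∀ {x s z t} l → (x , s) ∈ l → (z , t) ∈ children s → (x ++ z ∷ [] , t) ∈ expand l
  expand⁺ ((x , s) ∷ l) (here refl) zt∈ = ∈-++⁺ˡ (∈-map⁺ _ zt∈)
  expand⁺ ((x , s) ∷ l) (there xs∈) zt∈ = ∈-++⁺ʳ (graft x (children s)) (expand⁺ l xs∈ zt∈)

  level-Reach : ∀ n {y t} → (y , t) ∈ level n → Reach y t × length y ≡ suc n
  level-Reach zero (here refl) = root , refl
  level-Reach (suc n) yt∈ with x , s , z , xs∈ , refl , zt∈ ← expand⁻ (level n) yt∈ =
    let R , len = level-Reach n xs∈ in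
    grow R zt∈ , trans (length-∷ʳ x z) (cong suc len)

  module Enumeration
    (children-unique : ∀ s → Unique (map proj₁ (children s)))
    (root-avoids : Avoids (0 ∷ []) P)
    (child-≤ : ∀ {x s z t} → Reach x s → (z , t) ∈ children s → z ≤ suc (asc x))
    (child-avoids : ∀ {x s z t} → Reach x s → (z , t) ∈ children s → Avoids x P → Avoids (x ++ z ∷ []) P)
    (child-complete : ∀ {x s z} → Reach x s → z ≤ suc (asc x) → Avoids (x ++ z ∷ []) P → ∃[ t ] (z , t) ∈ children s)
    where

    Reach-InA : ∀ {x s} → Reach x s → IsAscentSeq x × Avoids x P
    Reach-InA root = IsAscentSeq-[0] , root-avoids
    Reach-InA (grow R c) =
      let asc-x , avoids-x = Reach-InA R in
      IsAscentSeq-∷ʳ asc-x (subst (_ ≤_) (sym (Reach-bound R)) (child-≤ R c)) , child-avoids R c avoids-x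

    unique-expand : ∀ l → Unique (map proj₁ l) → Unique (map proj₁ (expand l))
    unique-expand [] _ = []
    unique-expand ((x , s) ∷ l) (x∉l ∷ unique-l) =
      subst Unique (sym (map-++ proj₁ (graft x (children s)) (expand l)))
        (Unique.++⁺ unique-graft (unique-expand l unique-l) disjoint)
      where
      unique-graft : Unique (map proj₁ (graft x (children s)))
      unique-graft = subst Unique (sym (map-proj₁-graft x (children s)))
        (Unique.map⁺ (∷ʳ-injectiveʳ x x) (children-unique s))
      disjoint : ∀ {y} → ¬ (y ∈ map proj₁ (graft x (children s)) × y ∈ map proj₁ (expand l))
      disjoint (y∈graft , y∈expand)
        with (_ , t) , yt∈graft , refl ← ∈-map⁻ proj₁ y∈graft
           | (_ , t′) , yt∈expand , refl ← ∈-map⁻ proj₁ y∈expand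
        with (z , _) , _ , refl ← ∈-map⁻ _ yt∈graft
           | x′ , s′ , z′ , xs∈ , e , _ ← expand⁻ l yt∈expand
        with refl , _ ← ∷ʳ-injective x x′ e = All.lookup x∉l (∈-map⁺ proj₁ xs∈) refl

    unique-level : ∀ n → Unique (map proj₁ (level n))
    unique-level zero = [] ∷ []
    unique-level (suc n) = unique-expand (level n) (unique-level n)

    level-complete : ∀ n x → InA (suc n) P x → x ∈ map proj₁ (level n)
    level-complete zero (_ ∷ []) (asc-x , _ , _) with z≤n ← asc-x [] _ [] refl = here refl
    level-complete (suc n) x (asc-x , len , avoids-x) with initLast x
    ... | x′ ∷ʳ′ z
      with asc-x′ , z≤ ← IsAscentSeq-∷ʳ⁻ {x′} asc-x
      with len′ ← suc-injective (trans (sym (length-∷ʳ x′ z)) len)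
      with (_ , s) , xs∈ , refl ← ∈-map⁻ proj₁ (level-complete n x′ (asc-x′ , len′ , Avoids-++⁻ (z ∷ []) avoids-x))
      = let R , _ = level-Reach n xs∈
            t , zt∈ = child-complete R (subst (z ≤_) (Reach-bound R) z≤) avoids-x
        in ∈-map⁺ proj₁ (expand⁺ (level n) xs∈ zt∈)

    aCount-nodes : ∀ n → aCount P (suc n) (nodes s₀ n)
    aCount-nodes n = map proj₁ (level n) , unique-level n , (λ x → mk⇔ (level-InA x) (level-complete n x)) , length-level n
      where
      level-InA : ∀ x → x ∈ map proj₁ (level n) → InA (suc n) P x
      level-InA x x∈ with (_ , s) , xs∈ , refl ← ∈-map⁻ proj₁ x∈ =
        let R , len = level-Reach n xs∈ ; asc-x , avoids-x = Reach-InA R in asc-x , len , avoids-x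

closed-form : (f g : ℕ → ℕ) → f 0 ≡ 1 → (∀ d → f (suc d) ≡ f d + g d) →
              (∀ d → 2 * f d ≡ d * 2 ^ d + 2 → 2 * g d ≡ (d + 2) * 2 ^ d) →
              ∀ m → f m ≡ m * 2 ^ (m ∸ 1) + 1
closed-form f g f0≡1 f-step g-value m = halve m (doubled m)
  where
  open ≡-Reasoning
  doubled : ∀ d → 2 * f d ≡ d * 2 ^ d + 2
  doubled zero = cong (2 *_) f0≡1
  doubled (suc d) = begin
      2 * f (suc d)                    ≡⟨ cong (2 *_) (f-step d) ⟩
      2 * (f d + g d)                  ≡⟨ *-distribˡ-+ 2 (f d) (g d) ⟩
      2 * f d + 2 * g d                ≡⟨ cong₂ _+_ (doubled d) (g-value d (doubled d)) ⟩
      d * 2 ^ d + 2 + (d + 2) * 2 ^ d  ≡⟨ identity d (2 ^ d) ⟩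
      suc d * 2 ^ suc d + 2            ∎
    where
    identity : ∀ d p → d * p + 2 + (d + 2) * p ≡ suc d * (2 * p) + 2
    identity = solve-∀
  halve : ∀ m {y} → 2 * y ≡ m * 2 ^ m + 2 → y ≡ m * 2 ^ (m ∸ 1) + 1
  halve zero {y} 2y≡2 = *-cancelˡ-≡ y 1 2 2y≡2
  halve (suc m) {y} 2y≡ = *-cancelˡ-≡ y _ 2 (trans 2y≡ (identity m (2 ^ m)))
    where
    identity : ∀ m p → suc m * (2 * p) + 2 ≡ 2 * (suc m * p + 1)
    identity = solve-∀

module Avoiding-0101-0112 where

  Patterns : List (List ℕ)
  Patterns = (0 ∷ 1 ∷ 0 ∷ 1 ∷ []) ∷ (0 ∷ 1 ∷ 1 ∷ 2 ∷ []) ∷ []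

  -- fresh b r: x = y (b + 1) (b + 2) ⋯ (b + r), where y ends with 0 and has letters 0, …, b;
  -- falling b t: x = y (b + 1) ⋯ (b + r) w for such a y and a nonempty weakly decreasing word w
  -- over {b + 1, …, b + r} ending with b + t + 1; stuck e: a 0 has followed a falling word,
  -- and from then on only 0 can be appended.
  data Label : Set where
    fresh falling : ℕ → ℕ → Label
    stuck : ℕ → Label

  fallings : ℕ → ℕ → List (ℕ × Label)
  fallings b zero = []
  fallings b (suc r) = (suc (b + r) , falling b r) ∷ fallings b r

  children : Label → List (ℕ × Label)
  children (fresh b r) = (0 , fresh (b + r) 0) ∷ (suc (b + r) , fresh b (suc r)) ∷ fallings b r
  children (falling b t) = (0 , stuck (b + t)) ∷ fallings b (suc t)
  children (stuck e) = (0 , stuck e) ∷ []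

  ∈-fallings⁻ : ∀ {b r z t} → (z , t) ∈ fallings b r → ∃[ i ] i < r × z ≡ suc (b + i) × t ≡ falling b i
  ∈-fallings⁻ {r = suc r} (here refl) = r , ≤-refl , refl , refl
  ∈-fallings⁻ {r = suc r} (there zt∈) with i , i<r , e₁ , e₂ ← ∈-fallings⁻ zt∈ = i , m<n⇒m<1+n i<r , e₁ , e₂

  ∈-fallings⁺ : ∀ {b r i} → i < r → (suc (b + i) , falling b i) ∈ fallings b r
  ∈-fallings⁺ {r = suc r} i<1+r with m<1+n⇒m<n∨m≡n i<1+r
  ... | inj₁ i<r = there (∈-fallings⁺ i<r)
  ... | inj₂ refl = here refl

  fallings-letters : ∀ b r → All (λ z → 0 < z × z < suc (b + r)) (map proj₁ (fallings b r))
  fallings-letters b zero = []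
  fallings-letters b (suc r) = (s≤s z≤n , s≤s b+r<b+1+r)
    ∷ All.map (map₂ (λ z< → <-trans z< (s≤s b+r<b+1+r))) (fallings-letters b r)
    where
    b+r<b+1+r = +-monoʳ-< b (n<1+n r)

  fallings-unique : ∀ b r → Unique (map proj₁ (fallings b r))
  fallings-unique b zero = []
  fallings-unique b (suc r) = All.map (λ (_ , z<) e → <⇒≢ z< (sym e)) (fallings-letters b r) ∷ fallings-unique b r

  children-unique : ∀ s → Unique (map proj₁ (children s))
  children-unique (fresh b r) =
    ((λ ()) ∷ All.map (λ (0<z , _) e → <⇒≢ 0<z e) (fallings-letters b r))
    ∷ All.map (λ (_ , z<) e → <⇒≢ z< (sym e)) (fallings-letters b r) ∷ fallings-unique b r
  children-unique (falling b t) = All.map (λ (0<z , _) e → <⇒≢ 0<z e) (fallings-letters b (suc t)) ∷ fallings-unique b (suc t)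
  children-unique (stuck e) = [] ∷ []

  data Child : Label → ℕ → Label → Set where
    fresh-0 : ∀ {b r} → Child (fresh b r) 0 (fresh (b + r) 0)
    fresh-new : ∀ {b r} → Child (fresh b r) (suc (b + r)) (fresh b (suc r))
    fresh-fall : ∀ {b r i} → i < r → Child (fresh b r) (suc (b + i)) (falling b i)
    falling-0 : ∀ {b t} → Child (falling b t) 0 (stuck (b + t))
    falling-fall : ∀ {b t i} → i ≤ t → Child (falling b t) (suc (b + i)) (falling b i)
    stuck-0 : ∀ {e} → Child (stuck e) 0 (stuck e)

  child : ∀ {s z t} → (z , t) ∈ children s → Child s z t
  child {fresh b r} (here refl) = fresh-0
  child {fresh b r} (there (here refl)) = fresh-new
  child {fresh b r} (there (there zt∈)) with _ , i<r , refl , refl ← ∈-fallings⁻ zt∈ = fresh-fall i<r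
  child {falling b t} (here refl) = falling-0
  child {falling b t} (there zt∈) with _ , i<1+t , refl , refl ← ∈-fallings⁻ zt∈ = falling-fall (≤-pred i<1+t)
  child {stuck e} (here refl) = stuck-0

  child⁺ : ∀ {s z t} → Child s z t → (z , t) ∈ children s
  child⁺ fresh-0 = here refl
  child⁺ fresh-new = there (here refl)
  child⁺ (fresh-fall i<r) = there (there (∈-fallings⁺ i<r))
  child⁺ falling-0 = here refl
  child⁺ (falling-fall i≤t) = there (∈-fallings⁺ (s≤s i≤t))
  child⁺ stuck-0 = here refl

  open GeneratingTree Patterns (fresh 0 0) children

  LettersBounded : Label → List ℕ → Set
  LettersBounded (fresh b r) x = ∀ {v} → v ∈ x → v ≤ b + r
  LettersBounded _ x = ⊤

  letters-bounded : ∀ {x s} → Reach x s → LettersBounded s x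
  letters-bounded root (here refl) = z≤n
  letters-bounded (grow {x} {z = z} R c) = bounded-child (child c) (letters-bounded R)
    where
    bounded-∷ʳ : ∀ {m n} → (∀ {v} → v ∈ x → v ≤ m) → m ≤ n → z ≤ n → ∀ {v} → v ∈ x ++ z ∷ [] → v ≤ n
    bounded-∷ʳ x≤m m≤n z≤n′ v∈xz with ∈-∷ʳ⁻ x z v∈xz
    ... | inj₁ v∈x = ≤-trans (x≤m v∈x) m≤n
    ... | inj₂ refl = z≤n′
    bounded-child : ∀ {s t} → Child s z t → LettersBounded s x → LettersBounded t (x ++ z ∷ [])
    bounded-child (fresh-0 {b} {r}) x≤ = bounded-∷ʳ x≤ (≤-reflexive (sym (+-identityʳ (b + r)))) z≤n
    bounded-child (fresh-new {b} {r}) x≤ = bounded-∷ʳ x≤ (+-monoʳ-≤ b (n≤1+n r)) (≤-reflexive (sym (+-suc b r)))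
    bounded-child (fresh-fall _) _ = tt
    bounded-child falling-0 _ = tt
    bounded-child (falling-fall _) _ = tt
    bounded-child stuck-0 _ = tt

  AscentsOf : Label → ℕ → Set
  AscentsOf (fresh b r) n = n ≡ b + r
  AscentsOf (falling b t) n = suc (b + t) ≤ n
  AscentsOf (stuck e) n = ⊤

  ascents : ∀ {x s} → Reach x s → AscentsOf s (asc x)
  ascents root = refl
  ascents (grow {z = z} R c) with x′ , l , refl ← Reach-∷ʳ R =
    ascents-child (child c) (letters-bounded R) (ascents R)
    where
    x = x′ ++ l ∷ []
    l∈x : l ∈ x
    l∈x = ∈-++⁺ʳ x′ (here refl)
    ascents-child : ∀ {s t} → Child s z t → LettersBounded s x → AscentsOf s (asc x) → AscentsOf t (asc (x ++ z ∷ []))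
    ascents-child (fresh-0 {b} {r}) _ a≡ = trans (asc-∷ʳ-≤ x′ z≤n) (trans a≡ (sym (+-identityʳ (b + r))))
    ascents-child (fresh-new {b} {r}) x≤ a≡ = trans (asc-∷ʳ-< x′ (s≤s (x≤ l∈x))) (trans (cong suc a≡) (sym (+-suc b r)))
    ascents-child (fresh-fall {b} i<r) _ a≡ = ≤-trans (+-monoʳ-< b i<r) (≤-trans (≤-reflexive (sym a≡)) (asc-∷ʳ-mono x z))
    ascents-child falling-0 _ _ = tt
    ascents-child (falling-fall {b} i≤t) _ a≥ = ≤-trans (s≤s (+-monoʳ-≤ b i≤t)) (≤-trans a≥ (asc-∷ʳ-mono x z))
    ascents-child stuck-0 _ _ = tt

  child-≤ : ∀ {x s z t} → Reach x s → (z , t) ∈ children s → z ≤ suc (asc x)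
  child-≤ {x} R c = bound-child (child c) (ascents R)
    where
    bound-child : ∀ {s z t} → Child s z t → AscentsOf s (asc x) → z ≤ suc (asc x)
    bound-child fresh-0 _ = z≤n
    bound-child fresh-new a≡ = s≤s (≤-reflexive (sym a≡))
    bound-child (fresh-fall {b} i<r) a≡ = ≤-trans (+-monoʳ-< b i<r) (≤-trans (≤-reflexive (sym a≡)) (n≤1+n _))
    bound-child falling-0 _ = z≤n
    bound-child (falling-fall {b} i≤t) a≥ = ≤-trans (s≤s (+-monoʳ-≤ b i≤t)) (≤-trans a≥ (n≤1+n _))
    bound-child stuck-0 _ = z≤n

  Descents : Label → List ℕ → Set
  Descents (fresh b r) x = ∀ {v w} → v ∷ w ∷ [] ⊆ x → w < v → v ≤ b
  Descents (falling b t) x = ∀ {v w} → v ∷ w ∷ [] ⊆ x → w < v → v ≤ b ⊎ suc (b + t) ≤ w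
  Descents (stuck e) x = ⊤

  Repeats : Label → List ℕ → Set
  Repeats (fresh b r) x = ∀ {v} → v ∷ v ∷ [] ⊆ x → 0 < v → ⊥
  Repeats (falling b t) x = ∀ {v} → v ∷ v ∷ [] ⊆ x → 0 < v → suc (b + t) ≤ v
  Repeats (stuck e) x = ⊤

  descents : ∀ {x s} → Reach x s → Descents s x
  descents root (_ ∷ ()) _
  descents root (_ ∷ʳ ()) _
  descents (grow {x} {z = z} R c) = descents-child (child c) (letters-bounded R) (descents R)
    where
    descents-child : ∀ {s t} → Child s z t → LettersBounded s x → Descents s x → Descents t (x ++ z ∷ [])
    descents-child (fresh-0 {b} {r}) x≤ desc vw⊆ w<v with ⊆-∷ʳ⁻ (_ ∷ []) x z vw⊆
    ... | inj₁ vw⊆x = ≤-trans (desc vw⊆x w<v) (m≤m+n b r)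
    ... | inj₂ (v⊆x , refl) = x≤ (Any-resp-⊆ v⊆x (here refl))
    descents-child fresh-new x≤ desc vw⊆ w<v with ⊆-∷ʳ⁻ (_ ∷ []) x z vw⊆
    ... | inj₁ vw⊆x = desc vw⊆x w<v
    ... | inj₂ (v⊆x , refl) = ⊥-elim (<⇒≱ w<v (≤-trans (x≤ (Any-resp-⊆ v⊆x (here refl))) (n≤1+n _)))
    descents-child (fresh-fall _) _ desc vw⊆ w<v with ⊆-∷ʳ⁻ (_ ∷ []) x z vw⊆
    ... | inj₁ vw⊆x = inj₁ (desc vw⊆x w<v)
    ... | inj₂ (_ , refl) = inj₂ ≤-refl
    descents-child falling-0 _ _ = tt
    descents-child (falling-fall {b} i≤t) _ desc vw⊆ w<v with ⊆-∷ʳ⁻ (_ ∷ []) x z vw⊆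
    ... | inj₂ (_ , refl) = inj₂ ≤-refl
    ... | inj₁ vw⊆x with desc vw⊆x w<v
    ...   | inj₁ v≤b = inj₁ v≤b
    ...   | inj₂ w≥ = inj₂ (≤-trans (s≤s (+-monoʳ-≤ b i≤t)) w≥)
    descents-child stuck-0 _ _ = tt

  repeats : ∀ {x s} → Reach x s → Repeats s x
  repeats root (_ ∷ ()) _
  repeats root (_ ∷ʳ ()) _
  repeats (grow {x} {z = z} R c) = repeats-child (child c) (letters-bounded R) (repeats R)
    where
    repeats-child : ∀ {s t} → Child s z t → LettersBounded s x → Repeats s x → Repeats t (x ++ z ∷ [])
    repeats-child fresh-0 _ none vv⊆ 0<v with ⊆-∷ʳ⁻ (_ ∷ []) x z vv⊆
    ... | inj₁ vv⊆x = none vv⊆x 0<v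
    ... | inj₂ (_ , refl) = <⇒≱ 0<v z≤n
    repeats-child fresh-new x≤ none vv⊆ 0<v with ⊆-∷ʳ⁻ (_ ∷ []) x z vv⊆
    ... | inj₁ vv⊆x = none vv⊆x 0<v
    ... | inj₂ (v⊆x , refl) = 1+n≰n (x≤ (Any-resp-⊆ v⊆x (here refl)))
    repeats-child (fresh-fall _) _ none vv⊆ 0<v with ⊆-∷ʳ⁻ (_ ∷ []) x z vv⊆
    ... | inj₁ vv⊆x = ⊥-elim (none vv⊆x 0<v)
    ... | inj₂ (_ , refl) = ≤-refl
    repeats-child falling-0 _ _ = tt
    repeats-child (falling-fall {b} i≤t) _ rep vv⊆ 0<v with ⊆-∷ʳ⁻ (_ ∷ []) x z vv⊆
    ... | inj₁ vv⊆x = ≤-trans (s≤s (+-monoʳ-≤ b i≤t)) (rep vv⊆x 0<v)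
    ... | inj₂ (_ , refl) = ≤-refl
    repeats-child stuck-0 _ _ = tt

  Ups : ℕ → List ℕ → Set
  Ups n x = ∀ v → 0 < v → v ≤ n → 0 ∷ v ∷ [] ⊆ x

  Closed : ℕ → List ℕ → Set
  Closed n x = ∀ v → 0 < v → v ≤ n → 0 ∷ v ∷ 0 ∷ [] ⊆ x

  Ups-∷ʳ : ∀ {m n x z} → m ≤ n → Ups n x → Ups m (x ++ z ∷ [])
  Ups-∷ʳ m≤n ups v 0<v v≤m = ++⁺ʳ _ (ups v 0<v (≤-trans v≤m m≤n))

  Closed-∷ʳ : ∀ {n x z} → Closed n x → Closed n (x ++ z ∷ [])
  Closed-∷ʳ closed v 0<v v≤n = ++⁺ʳ _ (closed v 0<v v≤n)

  Witnesses : Label → List ℕ → Set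
  Witnesses (fresh b r) x = Ups (b + r) x × Closed b x
  Witnesses (falling b t) x = Ups (suc (b + t)) x × Closed b x × 0 ∷ suc (b + t) ∷ suc (b + t) ∷ [] ⊆ x
  Witnesses (stuck e) x = Closed (suc e) x × 0 ∷ suc e ∷ suc e ∷ [] ⊆ x

  witnesses : ∀ {x s} → Reach x s → Witnesses s x
  witnesses root = (λ { _ () z≤n }) , (λ { _ () z≤n })
  witnesses (grow {x} {z = z} R c) = witnesses-child (child c) (witnesses R)
    where
    witnesses-child : ∀ {s t} → Child s z t → Witnesses s x → Witnesses t (x ++ z ∷ [])
    witnesses-child (fresh-0 {b} {r}) (ups , _) =
      Ups-∷ʳ (≤-reflexive (+-identityʳ (b + r))) ups , λ v 0<v v≤ → ++⁺ (ups v 0<v v≤) ⊆-refl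
    witnesses-child (fresh-new {b} {r}) (ups , closed) = ups′ , Closed-∷ʳ closed
      where
      ups′ : Ups (b + suc r) (x ++ suc (b + r) ∷ [])
      ups′ v 0<v v≤ with m≤n⇒m<n∨m≡n (subst (v ≤_) (+-suc b r) v≤)
      ... | inj₁ v<1+b+r = ++⁺ʳ _ (ups v 0<v (≤-pred v<1+b+r))
      ... | inj₂ refl = ++⁺ (Reach-0 R) ⊆-refl
    witnesses-child (fresh-fall {b} i<r) (ups , closed) =
      Ups-∷ʳ z≤ ups , Closed-∷ʳ closed , ++⁺ (ups _ (s≤s z≤n) z≤) ⊆-refl
      where z≤ = +-monoʳ-< b i<r
    witnesses-child falling-0 (ups , _ , w) = (λ v 0<v v≤ → ++⁺ (ups v 0<v v≤) ⊆-refl) , ++⁺ʳ _ w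
    witnesses-child (falling-fall {b} i≤t) (ups , closed , _) =
      Ups-∷ʳ z≤ ups , Closed-∷ʳ closed , ++⁺ (ups _ (s≤s z≤n) z≤) ⊆-refl
      where z≤ = s≤s (+-monoʳ-≤ b i≤t)
    witnesses-child stuck-0 (closed , w) = Closed-∷ʳ closed , ++⁺ʳ _ w

  child-avoids : ∀ {x s z t} → Reach x s → (z , t) ∈ children s → Avoids x Patterns → Avoids (x ++ z ∷ []) Patterns
  child-avoids {x} {s} {z} R c (¬0101 ∷ ¬0112 ∷ []) =
    ¬Contains-∷ʳ red≡0101⇔ ¬0101 no-new-0101 ∷ ¬Contains-∷ʳ red≡0112⇔ ¬0112 no-new-0112 ∷ []
    where
    1+b+i≰b : ∀ b i → ¬ suc (b + i) ≤ b
    1+b+i≰b b i = <⇒≱ (s≤s (m≤m+n b i))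
    no-descent-from : ∀ {s t w} → Child s z t → Descents s x → z ∷ w ∷ [] ⊆ x → ¬ w < z
    no-descent-from fresh-0 _ _ w<z = <⇒≱ w<z z≤n
    no-descent-from (fresh-new {b} {r}) desc zw⊆x w<z = 1+b+i≰b b r (desc zw⊆x w<z)
    no-descent-from (fresh-fall {b} {i = i} _) desc zw⊆x w<z = 1+b+i≰b b i (desc zw⊆x w<z)
    no-descent-from falling-0 _ _ w<z = <⇒≱ w<z z≤n
    no-descent-from (falling-fall {b} {i = i} i≤t) desc zw⊆x w<z with desc zw⊆x w<z
    ... | inj₁ z≤b = 1+b+i≰b b i z≤b
    ... | inj₂ w≥ = <⇒≱ w<z (≤-trans (s≤s (+-monoʳ-≤ b i≤t)) w≥)
    no-descent-from stuck-0 _ _ w<z = <⇒≱ w<z z≤n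
    no-repeat-below : ∀ {s t v} → Child s z t → Repeats s x → v ∷ v ∷ [] ⊆ x → 0 < v → ¬ v < z
    no-repeat-below fresh-0 none vv⊆x 0<v _ = none vv⊆x 0<v
    no-repeat-below fresh-new none vv⊆x 0<v _ = none vv⊆x 0<v
    no-repeat-below (fresh-fall _) none vv⊆x 0<v _ = none vv⊆x 0<v
    no-repeat-below falling-0 _ _ _ v<z = <⇒≱ v<z z≤n
    no-repeat-below (falling-fall {b} i≤t) rep vv⊆x 0<v v<z = <⇒≱ v<z (≤-trans (s≤s (+-monoʳ-≤ b i≤t)) (rep vv⊆x 0<v))
    no-repeat-below stuck-0 _ _ _ v<z = <⇒≱ v<z z≤n
    no-new-0101 : ∀ {a b c} → a ∷ b ∷ c ∷ [] ⊆ x → ¬ (a < b × c ≡ a × z ≡ b)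
    no-new-0101 aba⊆x (a<b , refl , refl) = no-descent-from (child c) (descents R) (∷ˡ⁻ aba⊆x) a<b
    no-new-0112 : ∀ {a b c} → a ∷ b ∷ c ∷ [] ⊆ x → ¬ (a < b × c ≡ b × b < z)
    no-new-0112 abb⊆x (a<b , refl , b<z) =
      no-repeat-below (child c) (repeats R) (∷ˡ⁻ abb⊆x) (<-≤-trans (s≤s z≤n) a<b) b<z

  child-complete : ∀ {x s z} → Reach x s → z ≤ suc (asc x) → Avoids (x ++ z ∷ []) Patterns → ∃[ t ] (z , t) ∈ children s
  child-complete {x} {s} {z} R z≤ (¬0101 ∷ ¬0112 ∷ []) =
    map₂ child⁺ (admissible s z z≤ (ascents R) (witnesses R) no-0101 no-0112)
    where
    no-0101 : ∀ {a b c} → a ∷ b ∷ c ∷ [] ⊆ x → ¬ (a < b × c ≡ a × z ≡ b)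
    no-0101 = ¬Contains-∷ʳ⁻ red≡0101⇔ ¬0101
    no-0112 : ∀ {a b c} → a ∷ b ∷ c ∷ [] ⊆ x → ¬ (a < b × c ≡ b × b < z)
    no-0112 = ¬Contains-∷ʳ⁻ red≡0112⇔ ¬0112
    admissible : ∀ s z → z ≤ suc (asc x) → AscentsOf s (asc x) → Witnesses s x →
                 (∀ {a b c} → a ∷ b ∷ c ∷ [] ⊆ x → ¬ (a < b × c ≡ a × z ≡ b)) →
                 (∀ {a b c} → a ∷ b ∷ c ∷ [] ⊆ x → ¬ (a < b × c ≡ b × b < z)) → ∃[ t ] Child s z t
    admissible (fresh b r) zero _ _ _ _ _ = _ , fresh-0
    admissible (fresh b r) (suc v) (s≤s v≤) a≡ (_ , closed) no-0101 _ with v <? b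
    ... | yes v<b = ⊥-elim (no-0101 (closed (suc v) (s≤s z≤n) v<b) (s≤s z≤n , refl , refl))
    ... | no v≮b with i , refl ← m≤n⇒∃[o]m+o≡n (≮⇒≥ v≮b) with <-cmp i r
    ...   | tri< i<r _ _ = _ , fresh-fall i<r
    ...   | tri≈ _ refl _ = _ , fresh-new
    ...   | tri> _ _ r<i = ⊥-elim (<⇒≱ (+-monoʳ-< b r<i) (subst (b + i ≤_) a≡ v≤))
    admissible (falling b t) zero _ _ _ _ _ = _ , falling-0
    admissible (falling b t) (suc v) _ _ (_ , closed , w) no-0101 no-0112 with v <? b
    ... | yes v<b = ⊥-elim (no-0101 (closed (suc v) (s≤s z≤n) v<b) (s≤s z≤n , refl , refl))
    ... | no v≮b with i , refl ← m≤n⇒∃[o]m+o≡n (≮⇒≥ v≮b) with i ≤? t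
    ...   | yes i≤t = _ , falling-fall i≤t
    ...   | no i≰t = ⊥-elim (no-0112 w (s≤s z≤n , refl , s≤s (+-monoʳ-< b (≰⇒> i≰t))))
    admissible (stuck e) zero _ _ _ _ _ = _ , stuck-0
    admissible (stuck e) (suc v) _ _ (closed , w) no-0101 no-0112 with suc v ≤? suc e
    ... | yes v≤e = ⊥-elim (no-0101 (closed (suc v) (s≤s z≤n) v≤e) (s≤s z≤n , refl , refl))
    ... | no v≰e = ⊥-elim (no-0112 w (s≤s z≤n , refl , ≰⇒> v≰e))

  nodes-stuck : ∀ e d → nodes (stuck e) d ≡ 1
  nodes-stuck e zero = refl
  nodes-stuck e (suc d) = cong (_+ 0) (nodes-stuck e d)

  mutual
    nodes-falling-base : ∀ d b b′ t → nodes (falling b t) d ≡ nodes (falling b′ t) d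
    nodes-falling-base zero b b′ t = refl
    nodes-falling-base (suc d) b b′ t =
      cong₂ _+_ (trans (nodes-stuck _ d) (sym (nodes-stuck _ d))) (nodes-fallings-base d b b′ (suc t))

    nodes-fallings-base : ∀ d b b′ r → nodes* (fallings b r) d ≡ nodes* (fallings b′ r) d
    nodes-fallings-base d b b′ zero = refl
    nodes-fallings-base d b b′ (suc r) = cong₂ _+_ (nodes-falling-base d b b′ r) (nodes-fallings-base d b b′ r)

  nodes-fresh-base : ∀ d b b′ r → nodes (fresh b r) d ≡ nodes (fresh b′ r) d
  nodes-fresh-base zero b b′ r = refl
  nodes-fresh-base (suc d) b b′ r =
    cong₂ _+_ (nodes-fresh-base d (b + r) (b′ + r) 0) (cong₂ _+_ (nodes-fresh-base d b b′ (suc r)) (nodes-fallings-base d b b′ r))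

  mutual
    nodes-fresh-1 : ∀ d → nodes (fresh 0 1) d + 1 ≡ nodes (fresh 0 0) d + 2 ^ d
    nodes-fresh-1 zero = refl
    nodes-fresh-1 (suc d) = begin
        nodes (fresh 1 0) d + (F₂ + (G₀ + 0)) + 1
      ≡⟨ cong (λ n → n + (F₂ + (G₀ + 0)) + 1) (nodes-fresh-base d 1 0 0) ⟩
        F₀ + (F₂ + (G₀ + 0)) + 1
      ≡⟨ regroup F₀ F₂ G₀ ⟩
        (F₀ + F₂ + G₀) + 1
      ≡⟨ cong (_+ 1) (nodes-fresh-2 d 0) ⟩
        2 * F₁ + 2 ^ d + 1
      ≡⟨ split F₁ (2 ^ d) ⟩
        F₁ + (F₁ + 1) + 2 ^ d
      ≡⟨ cong (λ n → F₁ + n + 2 ^ d) (nodes-fresh-1 d) ⟩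
        F₁ + (F₀ + 2 ^ d) + 2 ^ d
      ≡⟨ merge F₀ F₁ (2 ^ d) ⟩
        F₀ + (F₁ + 0) + 2 * 2 ^ d
      ∎
      where
      open ≡-Reasoning
      F₀ = nodes (fresh 0 0) d
      F₁ = nodes (fresh 0 1) d
      F₂ = nodes (fresh 0 2) d
      G₀ = nodes (falling 0 0) d
      regroup : ∀ a b c → a + (b + (c + 0)) + 1 ≡ (a + b + c) + 1
      regroup = solve-∀
      split : ∀ a p → 2 * a + p + 1 ≡ a + (a + 1) + p
      split = solve-∀
      merge : ∀ a b p → b + (a + p) + p ≡ a + (b + 0) + 2 * p
      merge = solve-∀

    nodes-fresh-2 : ∀ d r → nodes (fresh 0 0) d + nodes (fresh 0 (2 + r)) d + nodes (falling 0 r) d ≡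
                            2 * nodes (fresh 0 (1 + r)) d + 2 ^ d
    nodes-fresh-2 zero r = refl
    nodes-fresh-2 (suc d) r = begin
        (F₀ + (F₁ + 0)) + (nodes (fresh (2 + r) 0) d + (F₃ + (G₁ + Gs₁))) + (nodes (stuck r) d + Gs₁)
      ≡⟨ cong₂ (λ m n → (F₀ + (F₁ + 0)) + (m + (F₃ + (G₁ + Gs₁))) + (n + Gs₁)) (nodes-fresh-base d (2 + r) 0 0) (nodes-stuck r d) ⟩
        (F₀ + (F₁ + 0)) + (F₀ + (F₃ + (G₁ + Gs₁))) + (1 + Gs₁)
      ≡⟨ regroup F₀ F₁ F₃ G₁ Gs₁ ⟩
        (F₀ + F₃ + G₁) + (F₁ + 1) + F₀ + 2 * Gs₁
      ≡⟨ cong₂ (λ m n → m + n + F₀ + 2 * Gs₁) (nodes-fresh-2 d (suc r)) (nodes-fresh-1 d) ⟩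
        (2 * F₂ + 2 ^ d) + (F₀ + 2 ^ d) + F₀ + 2 * Gs₁
      ≡⟨ merge F₀ F₂ Gs₁ (2 ^ d) ⟩
        2 * (F₀ + (F₂ + Gs₁)) + 2 * 2 ^ d
      ≡⟨ cong (λ n → 2 * (n + (F₂ + Gs₁)) + 2 * 2 ^ d) (nodes-fresh-base d (1 + r) 0 0) ⟨
        2 * (nodes (fresh (1 + r) 0) d + (F₂ + Gs₁)) + 2 * 2 ^ d
      ∎
      where
      open ≡-Reasoning
      F₀ = nodes (fresh 0 0) d
      F₁ = nodes (fresh 0 1) d
      F₂ = nodes (fresh 0 (2 + r)) d
      F₃ = nodes (fresh 0 (3 + r)) d
      G₁ = nodes (falling 0 (1 + r)) d
      Gs₁ = nodes* (fallings 0 (1 + r)) d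
      regroup : ∀ a b c e g → (a + (b + 0)) + (a + (c + (e + g))) + (1 + g) ≡ (a + c + e) + (b + 1) + a + 2 * g
      regroup = solve-∀
      merge : ∀ a c g p → (2 * c + p) + (a + p) + a + 2 * g ≡ 2 * (a + (c + g)) + 2 * p
      merge = solve-∀

  twice-nodes-fresh-1 : ∀ d → 2 * nodes (fresh 0 0) d ≡ d * 2 ^ d + 2 → 2 * nodes (fresh 0 1) d ≡ (d + 2) * 2 ^ d
  twice-nodes-fresh-1 d 2F₀≡ = +-cancelʳ-≡ 2 _ _ (begin
      2 * F₁ + 2                 ≡⟨ *-distribˡ-+ 2 F₁ 1 ⟨
      2 * (F₁ + 1)               ≡⟨ cong (2 *_) (nodes-fresh-1 d) ⟩
      2 * (F₀ + 2 ^ d)           ≡⟨ *-distribˡ-+ 2 F₀ (2 ^ d) ⟩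
      2 * F₀ + 2 * 2 ^ d         ≡⟨ cong (_+ 2 * 2 ^ d) 2F₀≡ ⟩
      d * 2 ^ d + 2 + 2 * 2 ^ d  ≡⟨ collect d (2 ^ d) ⟩
      (d + 2) * 2 ^ d + 2        ∎)
    where
    open ≡-Reasoning
    F₀ = nodes (fresh 0 0) d
    F₁ = nodes (fresh 0 1) d
    collect : ∀ d p → d * p + 2 + 2 * p ≡ (d + 2) * p + 2
    collect = solve-∀

  open Enumeration children-unique (Avoids-[0] (s≤s (s≤s z≤n) ∷ s≤s (s≤s z≤n) ∷ [])) child-≤ child-avoids child-complete

  aCount-formula : ∀ m → aCount Patterns (suc m) (m * 2 ^ (m ∸ 1) + 1)
  aCount-formula m = subst (aCount Patterns (suc m)) (closed-form (nodes (fresh 0 0)) (nodes (fresh 0 1)) refl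
    (λ d → cong (nodes (fresh 0 0) d +_) (+-identityʳ _)) twice-nodes-fresh-1 m) (aCount-nodes m)

module Avoiding-0102-0112 where

  Patterns : List (List ℕ)
  Patterns = (0 ∷ 1 ∷ 0 ∷ 2 ∷ []) ∷ (0 ∷ 1 ∷ 1 ∷ 2 ∷ []) ∷ []

  -- zeros: x = 0⋯0; increasing k: x = 0⋯0 1 2 ⋯ (k + 1); declined k: x is such a word followed by
  -- a nonempty weakly decreasing word of nonzero letters ending with k + 1; binary: some 0 follows
  -- a nonzero letter, and from then on only 0 and 1 can be appended.
  data Label : Set where
    zeros binary : Label
    increasing declined : ℕ → Label

  declines : ℕ → List (ℕ × Label)
  declines zero = (1 , declined 0) ∷ []
  declines (suc k) = (suc (suc k) , declined (suc k)) ∷ declines k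

  children : Label → List (ℕ × Label)
  children zeros = (0 , zeros) ∷ (1 , increasing 0) ∷ []
  children binary = (0 , binary) ∷ (1 , binary) ∷ []
  children (increasing k) = (0 , binary) ∷ (suc (suc k) , increasing (suc k)) ∷ declines k
  children (declined k) = (0 , binary) ∷ declines k

  ∈-declines⁻ : ∀ {k z t} → (z , t) ∈ declines k → ∃[ i ] i ≤ k × z ≡ suc i × t ≡ declined i
  ∈-declines⁻ {zero} (here refl) = 0 , z≤n , refl , refl
  ∈-declines⁻ {suc k} (here refl) = suc k , ≤-refl , refl , refl
  ∈-declines⁻ {suc k} (there zt∈) with i , i≤k , e₁ , e₂ ← ∈-declines⁻ {k} zt∈ = i , m≤n⇒m≤1+n i≤k , e₁ , e₂

  ∈-declines⁺ : ∀ {k i} → i ≤ k → (suc i , declined i) ∈ declines k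
  ∈-declines⁺ {zero} z≤n = here refl
  ∈-declines⁺ {suc k} i≤1+k with m≤n⇒m<n∨m≡n i≤1+k
  ... | inj₁ i<1+k = there (∈-declines⁺ (≤-pred i<1+k))
  ... | inj₂ refl = here refl

  declines-letters : ∀ k → All (λ z → 0 < z × z ≤ suc k) (map proj₁ (declines k))
  declines-letters zero = (s≤s z≤n , ≤-refl) ∷ []
  declines-letters (suc k) = (s≤s z≤n , ≤-refl) ∷ All.map (map₂ m≤n⇒m≤1+n) (declines-letters k)

  declines-unique : ∀ k → Unique (map proj₁ (declines k))
  declines-unique zero = [] ∷ []
  declines-unique (suc k) = All.map (λ (_ , z≤) e → <⇒≢ (s≤s z≤) (sym e)) (declines-letters k) ∷ declines-unique k

  children-unique : ∀ s → Unique (map proj₁ (children s))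
  children-unique zeros = ((λ ()) ∷ []) ∷ [] ∷ []
  children-unique binary = ((λ ()) ∷ []) ∷ [] ∷ []
  children-unique (increasing k) =
    ((λ ()) ∷ All.map (λ (0<z , _) e → <⇒≢ 0<z e) (declines-letters k))
    ∷ All.map (λ (_ , z≤) e → <⇒≢ (s≤s z≤) (sym e)) (declines-letters k) ∷ declines-unique k
  children-unique (declined k) = All.map (λ (0<z , _) e → <⇒≢ 0<z e) (declines-letters k) ∷ declines-unique k

  data Child : Label → ℕ → Label → Set where
    zeros-0 : Child zeros 0 zeros
    zeros-1 : Child zeros 1 (increasing 0)
    binary-0 : Child binary 0 binary
    binary-1 : Child binary 1 binary
    increasing-0 : ∀ {k} → Child (increasing k) 0 binary
    increasing-new : ∀ {k} → Child (increasing k) (suc (suc k)) (increasing (suc k))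
    increasing-decline : ∀ {k i} → i ≤ k → Child (increasing k) (suc i) (declined i)
    declined-0 : ∀ {k} → Child (declined k) 0 binary
    declined-decline : ∀ {k i} → i ≤ k → Child (declined k) (suc i) (declined i)

  child : ∀ {s z t} → (z , t) ∈ children s → Child s z t
  child {zeros} (here refl) = zeros-0
  child {zeros} (there (here refl)) = zeros-1
  child {binary} (here refl) = binary-0
  child {binary} (there (here refl)) = binary-1
  child {increasing k} (here refl) = increasing-0
  child {increasing k} (there (here refl)) = increasing-new
  child {increasing k} (there (there zt∈)) with _ , i≤k , refl , refl ← ∈-declines⁻ zt∈ = increasing-decline i≤k
  child {declined k} (here refl) = declined-0
  child {declined k} (there zt∈) with _ , i≤k , refl , refl ← ∈-declines⁻ zt∈ = declined-decline i≤k

  child⁺ : ∀ {s z t} → Child s z t → (z , t) ∈ children s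
  child⁺ zeros-0 = here refl
  child⁺ zeros-1 = there (here refl)
  child⁺ binary-0 = here refl
  child⁺ binary-1 = there (here refl)
  child⁺ increasing-0 = here refl
  child⁺ increasing-new = there (here refl)
  child⁺ (increasing-decline i≤k) = there (there (∈-declines⁺ i≤k))
  child⁺ declined-0 = here refl
  child⁺ (declined-decline i≤k) = there (∈-declines⁺ i≤k)

  open GeneratingTree Patterns zeros children

  LettersBounded : Label → List ℕ → Set
  LettersBounded zeros x = ∀ {v} → v ∈ x → v ≤ 0
  LettersBounded (increasing k) x = ∀ {v} → v ∈ x → v ≤ suc k
  LettersBounded _ x = ⊤

  letters-bounded : ∀ {x s} → Reach x s → LettersBounded s x
  letters-bounded root (here refl) = z≤n
  letters-bounded (grow {x} {z = z} R c) = bounded-child (child c) (letters-bounded R)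
    where
    bounded-∷ʳ : ∀ {m n} → (∀ {v} → v ∈ x → v ≤ m) → m ≤ n → z ≤ n → ∀ {v} → v ∈ x ++ z ∷ [] → v ≤ n
    bounded-∷ʳ x≤m m≤n z≤n′ v∈xz with ∈-∷ʳ⁻ x z v∈xz
    ... | inj₁ v∈x = ≤-trans (x≤m v∈x) m≤n
    ... | inj₂ refl = z≤n′
    bounded-child : ∀ {s t} → Child s z t → LettersBounded s x → LettersBounded t (x ++ z ∷ [])
    bounded-child zeros-0 x≤0 = bounded-∷ʳ x≤0 z≤n z≤n
    bounded-child zeros-1 x≤0 = bounded-∷ʳ x≤0 z≤n ≤-refl
    bounded-child binary-0 _ = tt
    bounded-child binary-1 _ = tt
    bounded-child increasing-0 _ = tt
    bounded-child increasing-new x≤ = bounded-∷ʳ x≤ (n≤1+n _) ≤-refl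
    bounded-child (increasing-decline _) _ = tt
    bounded-child declined-0 _ = tt
    bounded-child (declined-decline _) _ = tt

  AscentsOf : Label → ℕ → Set
  AscentsOf zeros n = n ≡ 0
  AscentsOf (increasing k) n = n ≡ suc k
  AscentsOf (declined k) n = suc k ≤ n
  AscentsOf binary n = ⊤

  ascents : ∀ {x s} → Reach x s → AscentsOf s (asc x)
  ascents root = refl
  ascents (grow {z = z} R c) with x′ , l , refl ← Reach-∷ʳ R =
    ascents-child (child c) (letters-bounded R) (ascents R)
    where
    x = x′ ++ l ∷ []
    l∈x : l ∈ x
    l∈x = ∈-++⁺ʳ x′ (here refl)
    ascents-child : ∀ {s t} → Child s z t → LettersBounded s x → AscentsOf s (asc x) → AscentsOf t (asc (x ++ z ∷ []))
    ascents-child zeros-0 _ a≡ = trans (asc-∷ʳ-≤ x′ z≤n) a≡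
    ascents-child zeros-1 x≤0 a≡ = trans (asc-∷ʳ-< x′ (s≤s (x≤0 l∈x))) (cong suc a≡)
    ascents-child binary-0 _ _ = tt
    ascents-child binary-1 _ _ = tt
    ascents-child increasing-0 _ _ = tt
    ascents-child increasing-new x≤ a≡ = trans (asc-∷ʳ-< x′ (s≤s (x≤ l∈x))) (cong suc a≡)
    ascents-child (increasing-decline i≤k) _ a≡ = ≤-trans (s≤s i≤k) (≤-trans (≤-reflexive (sym a≡)) (asc-∷ʳ-mono x z))
    ascents-child declined-0 _ _ = tt
    ascents-child (declined-decline i≤k) _ a≥ = ≤-trans (s≤s i≤k) (≤-trans a≥ (asc-∷ʳ-mono x z))

  child-≤ : ∀ {x s z t} → Reach x s → (z , t) ∈ children s → z ≤ suc (asc x)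
  child-≤ {x} R c = bound-child (child c) (ascents R)
    where
    bound-child : ∀ {s z t} → Child s z t → AscentsOf s (asc x) → z ≤ suc (asc x)
    bound-child zeros-0 _ = z≤n
    bound-child zeros-1 _ = s≤s z≤n
    bound-child binary-0 _ = z≤n
    bound-child binary-1 _ = s≤s z≤n
    bound-child increasing-0 _ = z≤n
    bound-child increasing-new a≡ = s≤s (≤-reflexive (sym a≡))
    bound-child (increasing-decline i≤k) a≡ = s≤s (≤-trans i≤k (≤-trans (n≤1+n _) (≤-reflexive (sym a≡))))
    bound-child declined-0 _ = z≤n
    bound-child (declined-decline i≤k) a≥ = ≤-trans (s≤s i≤k) (≤-trans a≥ (n≤1+n _))

  Declines : Label → List ℕ → Set
  Declines zeros x = ∀ {b c} → b ∷ c ∷ [] ⊆ x → 0 < b → c ≤ b → ⊥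
  Declines (increasing k) x = ∀ {b c} → b ∷ c ∷ [] ⊆ x → 0 < b → c ≤ b → ⊥
  Declines (declined k) x = ∀ {b c} → b ∷ c ∷ [] ⊆ x → 0 < b → c ≤ b → suc k ≤ c
  Declines binary x = ⊤

  declines-bounded : ∀ {x s} → Reach x s → Declines s x
  declines-bounded root (_ ∷ ())
  declines-bounded root (_ ∷ʳ ())
  declines-bounded (grow {x} {z = z} R c) = declines-child (child c) (letters-bounded R) (declines-bounded R)
    where
    declines-child : ∀ {s t} → Child s z t → LettersBounded s x → Declines s x → Declines t (x ++ z ∷ [])
    declines-child binary-0 _ _ = tt
    declines-child binary-1 _ _ = tt
    declines-child increasing-0 _ _ = tt
    declines-child declined-0 _ _ = tt
    declines-child zeros-0 x≤0 none bc⊆ 0<b c≤b with ⊆-∷ʳ⁻ (_ ∷ []) x z bc⊆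
    ... | inj₁ bc⊆x = none bc⊆x 0<b c≤b
    ... | inj₂ (b⊆x , refl) = <⇒≱ 0<b (x≤0 (Any-resp-⊆ b⊆x (here refl)))
    declines-child zeros-1 x≤0 none bc⊆ 0<b c≤b with ⊆-∷ʳ⁻ (_ ∷ []) x z bc⊆
    ... | inj₁ bc⊆x = none bc⊆x 0<b c≤b
    ... | inj₂ (b⊆x , refl) = <⇒≱ 0<b (x≤0 (Any-resp-⊆ b⊆x (here refl)))
    declines-child increasing-new x≤ none bc⊆ 0<b c≤b with ⊆-∷ʳ⁻ (_ ∷ []) x z bc⊆
    ... | inj₁ bc⊆x = none bc⊆x 0<b c≤b
    ... | inj₂ (b⊆x , refl) = 1+n≰n (≤-trans c≤b (x≤ (Any-resp-⊆ b⊆x (here refl))))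
    declines-child (increasing-decline _) _ none bc⊆ 0<b c≤b with ⊆-∷ʳ⁻ (_ ∷ []) x z bc⊆
    ... | inj₁ bc⊆x = ⊥-elim (none bc⊆x 0<b c≤b)
    ... | inj₂ (_ , refl) = ≤-refl
    declines-child (declined-decline i≤k) _ bounded bc⊆ 0<b c≤b with ⊆-∷ʳ⁻ (_ ∷ []) x z bc⊆
    ... | inj₁ bc⊆x = ≤-trans (s≤s i≤k) (bounded bc⊆x 0<b c≤b)
    ... | inj₂ (_ , refl) = ≤-refl

  Ups : ℕ → List ℕ → Set
  Ups k x = ∀ i → i ≤ k → 0 ∷ suc i ∷ [] ⊆ x

  Ups-∷ʳ : ∀ {j k x z} → j ≤ k → Ups k x → Ups j (x ++ z ∷ [])
  Ups-∷ʳ j≤k ups i i≤j = ++⁺ʳ _ (ups i (≤-trans i≤j j≤k))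

  Witnesses : Label → List ℕ → Set
  Witnesses zeros x = ⊤
  Witnesses (increasing k) x = Ups k x
  Witnesses (declined k) x = Ups k x × 0 ∷ suc k ∷ suc k ∷ [] ⊆ x
  Witnesses binary x = 0 ∷ 1 ∷ 0 ∷ [] ⊆ x

  witnesses : ∀ {x s} → Reach x s → Witnesses s x
  witnesses root = tt
  witnesses (grow {x} {z = z} R c) = witnesses-child (child c) (witnesses R)
    where
    witnesses-child : ∀ {s t} → Child s z t → Witnesses s x → Witnesses t (x ++ z ∷ [])
    witnesses-child zeros-0 _ = tt
    witnesses-child zeros-1 _ zero z≤n = ++⁺ (Reach-0 R) ⊆-refl
    witnesses-child binary-0 w = ++⁺ʳ _ w
    witnesses-child binary-1 w = ++⁺ʳ _ w
    witnesses-child increasing-0 ups = ++⁺ (ups 0 z≤n) ⊆-refl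
    witnesses-child (increasing-new {k}) ups i i≤1+k with m≤n⇒m<n∨m≡n i≤1+k
    ... | inj₁ i<1+k = ++⁺ʳ _ (ups i (≤-pred i<1+k))
    ... | inj₂ refl = ++⁺ (Reach-0 R) ⊆-refl
    witnesses-child (increasing-decline {i = i} i≤k) ups = Ups-∷ʳ i≤k ups , ++⁺ (ups i i≤k) ⊆-refl
    witnesses-child declined-0 (ups , _) = ++⁺ (ups 0 z≤n) ⊆-refl
    witnesses-child (declined-decline {i = i} i≤k) (ups , _) = Ups-∷ʳ i≤k ups , ++⁺ (ups i i≤k) ⊆-refl

  child-avoids : ∀ {x s z t} → Reach x s → (z , t) ∈ children s → Avoids x Patterns → Avoids (x ++ z ∷ []) Patterns
  child-avoids {x} {s} {z} R c (¬0102 ∷ ¬0112 ∷ []) =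
    ¬Contains-∷ʳ red≡0102⇔ ¬0102 no-new-0102 ∷ ¬Contains-∷ʳ red≡0112⇔ ¬0112 no-new-0112 ∷ []
    where
    no-decline-below : ∀ {s t b c} → Child s z t → Declines s x → b ∷ c ∷ [] ⊆ x → 0 < b → c ≤ b → ¬ b < z
    no-decline-below zeros-0 none bc⊆x 0<b c≤b _ = none bc⊆x 0<b c≤b
    no-decline-below zeros-1 none bc⊆x 0<b c≤b _ = none bc⊆x 0<b c≤b
    no-decline-below increasing-0 none bc⊆x 0<b c≤b _ = none bc⊆x 0<b c≤b
    no-decline-below increasing-new none bc⊆x 0<b c≤b _ = none bc⊆x 0<b c≤b
    no-decline-below (increasing-decline _) none bc⊆x 0<b c≤b _ = none bc⊆x 0<b c≤b
    no-decline-below binary-0 _ _ _ _ b<z = <⇒≱ b<z z≤n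
    no-decline-below binary-1 _ _ 0<b _ b<z = <⇒≱ b<z 0<b
    no-decline-below declined-0 _ _ _ _ b<z = <⇒≱ b<z z≤n
    no-decline-below (declined-decline i≤k) bounded bc⊆x 0<b c≤b b<z =
      <⇒≱ b<z (≤-trans (s≤s i≤k) (≤-trans (bounded bc⊆x 0<b c≤b) c≤b))
    no-new-0102 : ∀ {a b c} → a ∷ b ∷ c ∷ [] ⊆ x → ¬ (a < b × c ≡ a × b < z)
    no-new-0102 aba⊆x (a<b , refl , b<z) =
      no-decline-below (child c) (declines-bounded R) (∷ˡ⁻ aba⊆x) (<-≤-trans (s≤s z≤n) a<b) (<⇒≤ a<b) b<z
    no-new-0112 : ∀ {a b c} → a ∷ b ∷ c ∷ [] ⊆ x → ¬ (a < b × c ≡ b × b < z)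
    no-new-0112 abb⊆x (a<b , refl , b<z) =
      no-decline-below (child c) (declines-bounded R) (∷ˡ⁻ abb⊆x) (<-≤-trans (s≤s z≤n) a<b) ≤-refl b<z

  child-complete : ∀ {x s z} → Reach x s → z ≤ suc (asc x) → Avoids (x ++ z ∷ []) Patterns → ∃[ t ] (z , t) ∈ children s
  child-complete {x} {s} {z} R z≤ (¬0102 ∷ ¬0112 ∷ []) =
    map₂ child⁺ (admissible s z z≤ (ascents R) (witnesses R) no-0102 no-0112)
    where
    no-0102 : ∀ {a b c} → a ∷ b ∷ c ∷ [] ⊆ x → ¬ (a < b × c ≡ a × b < z)
    no-0102 = ¬Contains-∷ʳ⁻ red≡0102⇔ ¬0102
    no-0112 : ∀ {a b c} → a ∷ b ∷ c ∷ [] ⊆ x → ¬ (a < b × c ≡ b × b < z)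
    no-0112 = ¬Contains-∷ʳ⁻ red≡0112⇔ ¬0112
    admissible : ∀ s z → z ≤ suc (asc x) → AscentsOf s (asc x) → Witnesses s x →
                 (∀ {a b c} → a ∷ b ∷ c ∷ [] ⊆ x → ¬ (a < b × c ≡ a × b < z)) →
                 (∀ {a b c} → a ∷ b ∷ c ∷ [] ⊆ x → ¬ (a < b × c ≡ b × b < z)) → ∃[ t ] Child s z t
    admissible zeros zero _ _ _ _ _ = _ , zeros-0
    admissible zeros (suc zero) _ _ _ _ _ = _ , zeros-1
    admissible zeros (suc (suc _)) (s≤s 1+z≤) a≡0 _ _ _ = ⊥-elim (<⇒≱ (s≤s z≤n) (subst (_ ≤_) a≡0 1+z≤))
    admissible binary zero _ _ _ _ _ = _ , binary-0
    admissible binary (suc zero) _ _ _ _ _ = _ , binary-1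
    admissible binary (suc (suc _)) _ _ w no-0102 _ = ⊥-elim (no-0102 w (s≤s z≤n , refl , s≤s (s≤s z≤n)))
    admissible (increasing k) zero _ _ _ _ _ = _ , increasing-0
    admissible (increasing k) (suc i) (s≤s i≤) a≡ _ _ _ with i ≤? k
    ... | yes i≤k = _ , increasing-decline i≤k
    ... | no i≰k with m≤n⇒m<n∨m≡n (subst (i ≤_) a≡ i≤)
    ...   | inj₁ i<1+k = ⊥-elim (i≰k (≤-pred i<1+k))
    ...   | inj₂ refl = _ , increasing-new
    admissible (declined k) zero _ _ _ _ _ = _ , declined-0
    admissible (declined k) (suc i) _ _ (_ , w) _ no-0112 with i ≤? k
    ... | yes i≤k = _ , declined-decline i≤k
    ... | no i≰k = ⊥-elim (no-0112 w (s≤s z≤n , refl , s≤s (≰⇒> i≰k)))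

  nodes-binary : ∀ d → nodes binary d ≡ 2 ^ d
  nodes-binary zero = refl
  nodes-binary (suc d) = cong₂ (λ m n → m + (n + 0)) (nodes-binary d) (nodes-binary d)

  nodes-declined-0 : ∀ d → nodes (declined 0) d ≡ 2 ^ d
  nodes-declined-0 zero = refl
  nodes-declined-0 (suc d) = cong₂ (λ m n → m + (n + 0)) (nodes-binary d) (nodes-declined-0 d)

  nodes-declined-suc : ∀ k d → nodes (declined (suc k)) (suc d) ≡ nodes (declined k) (suc d) + nodes (declined (suc k)) d
  nodes-declined-suc k d = swap (nodes binary d) (nodes (declined (suc k)) d) (nodes* (declines k) d)
    where
    swap : ∀ m n o → m + (n + o) ≡ (m + o) + n
    swap = solve-∀

  nodes-increasing-unfold : ∀ k d → nodes (increasing k) (suc d) ≡ nodes (increasing (suc k)) d + nodes (declined k) (suc d)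
  nodes-increasing-unfold k d = swap (nodes binary d) (nodes (increasing (suc k)) d) (nodes* (declines k) d)
    where
    swap : ∀ m n o → m + (n + o) ≡ n + (m + o)
    swap = solve-∀

  nodes-increasing-suc : ∀ d k → nodes (increasing (suc k)) (suc d) ≡ nodes (increasing k) (suc d) + nodes (increasing (suc k)) d
  nodes-increasing-suc zero k = +-comm 1 _
  nodes-increasing-suc (suc d) k = begin
      nodes (increasing (suc k)) (suc (suc d))
    ≡⟨ nodes-increasing-unfold (suc k) (suc d) ⟩
      nodes (increasing (suc (suc k))) (suc d) + nodes (declined (suc k)) (suc (suc d))
    ≡⟨ cong₂ _+_ (nodes-increasing-suc d (suc k)) (nodes-declined-suc k (suc d)) ⟩
      (I₁ + I₂) + (D₀ + D₁)
    ≡⟨ interchange I₁ I₂ D₀ D₁ ⟩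
      (I₁ + D₀) + (I₂ + D₁)
    ≡⟨ cong₂ _+_ (nodes-increasing-unfold k (suc d)) (nodes-increasing-unfold (suc k) d) ⟨
      nodes (increasing k) (suc (suc d)) + nodes (increasing (suc k)) (suc d)
    ∎
    where
    open ≡-Reasoning
    I₁ = nodes (increasing (suc k)) (suc d)
    I₂ = nodes (increasing (suc (suc k))) d
    D₀ = nodes (declined k) (suc (suc d))
    D₁ = nodes (declined (suc k)) (suc d)
    interchange : ∀ a b c e → (a + b) + (c + e) ≡ (a + c) + (b + e)
    interchange = solve-∀

  nodes-increasing-0 : ∀ d → 2 * nodes (increasing 0) d ≡ (d + 2) * 2 ^ d
  nodes-increasing-0 zero = refl
  nodes-increasing-0 (suc zero) = refl
  nodes-increasing-0 (suc (suc d)) = begin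
      2 * nodes (increasing 0) (suc (suc d))
    ≡⟨ cong (2 *_) (nodes-increasing-unfold 0 (suc d)) ⟩
      2 * (nodes (increasing 1) (suc d) + nodes (declined 0) (suc (suc d)))
    ≡⟨ cong₂ (λ m n → 2 * (m + n)) (nodes-increasing-suc d 0) (nodes-declined-0 (suc (suc d))) ⟩
      2 * ((I₀ + nodes (increasing 1) d) + 2 * 2 ^ suc d)
    ≡⟨ rearrange I₀ (nodes (increasing 1) d) (2 ^ suc d) I₀≡ ⟩
      2 * I₀ + 2 * I₀ + 2 * 2 ^ suc d
    ≡⟨ cong (λ m → m + m + 2 * 2 ^ suc d) (nodes-increasing-0 (suc d)) ⟩
      (suc d + 2) * 2 ^ suc d + (suc d + 2) * 2 ^ suc d + 2 * 2 ^ suc d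
    ≡⟨ collect (suc d) (2 ^ suc d) ⟩
      (suc (suc d) + 2) * 2 ^ suc (suc d)
    ∎
    where
    open ≡-Reasoning
    I₀ = nodes (increasing 0) (suc d)
    I₀≡ : nodes (increasing 1) d + 2 ^ suc d ≡ I₀
    I₀≡ = trans (cong (nodes (increasing 1) d +_) (sym (nodes-declined-0 (suc d)))) (sym (nodes-increasing-unfold 0 d))
    rearrange : ∀ a b p → b + p ≡ a → 2 * ((a + b) + 2 * p) ≡ 2 * a + 2 * a + 2 * p
    rearrange .(b + p) b p refl = identity b p
      where
      identity : ∀ b p → 2 * ((b + p + b) + 2 * p) ≡ 2 * (b + p) + 2 * (b + p) + 2 * p
      identity = solve-∀
    collect : ∀ d p → (d + 2) * p + (d + 2) * p + 2 * p ≡ (suc d + 2) * (2 * p)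
    collect = solve-∀

  open Enumeration children-unique (Avoids-[0] (s≤s (s≤s z≤n) ∷ s≤s (s≤s z≤n) ∷ [])) child-≤ child-avoids child-complete

  aCount-formula : ∀ m → aCount Patterns (suc m) (m * 2 ^ (m ∸ 1) + 1)
  aCount-formula m = subst (aCount Patterns (suc m)) (closed-form (nodes zeros) (nodes (increasing 0)) refl
    (λ d → cong (nodes zeros d +_) (+-identityʳ _)) (λ d _ → nodes-increasing-0 d) m) (aCount-nodes m)

module Avoiding-0121-0112 where

  Patterns : List (List ℕ)
  Patterns = (0 ∷ 1 ∷ 2 ∷ 1 ∷ []) ∷ (0 ∷ 1 ∷ 1 ∷ 2 ∷ []) ∷ []

  -- zeros: x consists of zeros; rising k: the nonzero letters of x are 1, 2, …, k + 1 in this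
  -- order; repeated k: as for rising k, except that k + 1 occurs more than once.
  data Label : Set where
    zeros : Label
    rising repeated : ℕ → Label

  children : Label → List (ℕ × Label)
  children zeros = (0 , zeros) ∷ (1 , rising 0) ∷ []
  children (rising k) = (0 , rising k) ∷ (suc k , repeated k) ∷ (suc (suc k) , rising (suc k)) ∷ []
  children (repeated k) = (0 , repeated k) ∷ (suc k , repeated k) ∷ []

  data Child : Label → ℕ → Label → Set where
    zeros-0 : Child zeros 0 zeros
    zeros-1 : Child zeros 1 (rising 0)
    rising-0 : ∀ {k} → Child (rising k) 0 (rising k)
    rising-top : ∀ {k} → Child (rising k) (suc k) (repeated k)
    rising-new : ∀ {k} → Child (rising k) (suc (suc k)) (rising (suc k))
    repeated-0 : ∀ {k} → Child (repeated k) 0 (repeated k)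
    repeated-top : ∀ {k} → Child (repeated k) (suc k) (repeated k)

  child : ∀ {s z t} → (z , t) ∈ children s → Child s z t
  child {zeros} (here refl) = zeros-0
  child {zeros} (there (here refl)) = zeros-1
  child {rising k} (here refl) = rising-0
  child {rising k} (there (here refl)) = rising-top
  child {rising k} (there (there (here refl))) = rising-new
  child {repeated k} (here refl) = repeated-0
  child {repeated k} (there (here refl)) = repeated-top

  child⁺ : ∀ {s z t} → Child s z t → (z , t) ∈ children s
  child⁺ zeros-0 = here refl
  child⁺ zeros-1 = there (here refl)
  child⁺ rising-0 = here refl
  child⁺ rising-top = there (here refl)
  child⁺ rising-new = there (there (here refl))
  child⁺ repeated-0 = here refl
  child⁺ repeated-top = there (here refl)

  children-unique : ∀ s → Unique (map proj₁ (children s))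
  children-unique zeros = ((λ ()) ∷ []) ∷ [] ∷ []
  children-unique (rising k) = ((λ ()) ∷ (λ ()) ∷ []) ∷ ((λ e → 1+n≢n (sym e)) ∷ []) ∷ [] ∷ []
  children-unique (repeated k) = ((λ ()) ∷ []) ∷ [] ∷ []

  open GeneratingTree Patterns zeros children

  top : Label → ℕ
  top zeros = 0
  top (rising k) = suc k
  top (repeated k) = suc k

  top-child : ∀ {s z t} → (z , t) ∈ children s → top s ≤ top t × z ≤ top t
  top-child c with child c
  ... | zeros-0 = z≤n , z≤n
  ... | zeros-1 = z≤n , ≤-refl
  ... | rising-0 = ≤-refl , z≤n
  ... | rising-top = ≤-refl , ≤-refl
  ... | rising-new = n≤1+n _ , ≤-refl
  ... | repeated-0 = ≤-refl , z≤n
  ... | repeated-top = ≤-refl , ≤-refl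

  letter≤top : ∀ {x s v} → Reach x s → v ∈ x → v ≤ top s
  letter≤top = Reach-letters-≤ top top-child

  AscentsOf : Label → ℕ → Set
  AscentsOf zeros n = n ≡ 0
  AscentsOf (rising k) n = n ≡ suc k
  AscentsOf (repeated k) n = suc k ≤ n

  ascents : ∀ {x s} → Reach x s → AscentsOf s (asc x)
  ascents root = refl
  ascents (grow {z = z} R c) with x′ , l , refl ← Reach-∷ʳ R =
    ascents-child (child c) (letter≤top R (∈-++⁺ʳ x′ (here refl))) (ascents R)
    where
    x = x′ ++ l ∷ []
    ascents-child : ∀ {s t} → Child s z t → l ≤ top s → AscentsOf s (asc x) → AscentsOf t (asc (x ++ z ∷ []))
    ascents-child zeros-0 _ a≡ = trans (asc-∷ʳ-≤ x′ z≤n) a≡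
    ascents-child zeros-1 l≤0 a≡ = trans (asc-∷ʳ-< x′ (s≤s l≤0)) (cong suc a≡)
    ascents-child rising-0 _ a≡ = trans (asc-∷ʳ-≤ x′ z≤n) a≡
    ascents-child rising-top _ a≡ = ≤-trans (≤-reflexive (sym a≡)) (asc-∷ʳ-mono x z)
    ascents-child rising-new l≤top a≡ = trans (asc-∷ʳ-< x′ (s≤s l≤top)) (cong suc a≡)
    ascents-child repeated-0 _ a≥ = ≤-trans a≥ (asc-∷ʳ-mono x z)
    ascents-child repeated-top _ a≥ = ≤-trans a≥ (asc-∷ʳ-mono x z)

  child-≤ : ∀ {x s z t} → Reach x s → (z , t) ∈ children s → z ≤ suc (asc x)
  child-≤ {x} R c = bound-child (child c) (ascents R)
    where
    bound-child : ∀ {s z t} → Child s z t → AscentsOf s (asc x) → z ≤ suc (asc x)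
    bound-child zeros-0 _ = z≤n
    bound-child zeros-1 _ = s≤s z≤n
    bound-child rising-0 _ = z≤n
    bound-child rising-top a≡ = ≤-trans (n≤1+n _) (s≤s (≤-reflexive (sym a≡)))
    bound-child rising-new a≡ = s≤s (≤-reflexive (sym a≡))
    bound-child repeated-0 _ = z≤n
    bound-child repeated-top a≥ = ≤-trans a≥ (n≤1+n _)

  Repeats : Label → ℕ → Set
  Repeats (repeated k) b = b ≡ suc k
  Repeats _ _ = ⊥

  repeats : ∀ {x s a b} → Reach x s → a ∷ b ∷ b ∷ [] ⊆ x → a < b → Repeats s b
  repeats root (_ ∷ ()) _
  repeats root (_ ∷ʳ ()) _
  repeats {a = a} {b} (grow {x} {z = z} R c) sub a<b with ⊆-∷ʳ⁻ (a ∷ b ∷ []) x z sub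
  ... | inj₁ abb⊆x = repeats-child (child c) (repeats R abb⊆x a<b)
    where
    repeats-child : ∀ {s t} → Child s z t → Repeats s b → Repeats t b
    repeats-child repeated-0 b≡ = b≡
    repeats-child repeated-top b≡ = b≡
  ... | inj₂ (ab⊆x , refl) = repeats-new (child c) (letter≤top R (Any-resp-⊆ ab⊆x (there (here refl))))
    where
    repeats-new : ∀ {s t} → Child s b t → b ≤ top s → Repeats t b
    repeats-new zeros-0 _ = ⊥-elim (<⇒≱ a<b z≤n)
    repeats-new zeros-1 ()
    repeats-new rising-0 _ = ⊥-elim (<⇒≱ a<b z≤n)
    repeats-new rising-top _ = refl
    repeats-new rising-new b≤top = ⊥-elim (1+n≰n b≤top)
    repeats-new repeated-0 _ = ⊥-elim (<⇒≱ a<b z≤n)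
    repeats-new repeated-top _ = refl

  Stair : ℕ → List ℕ → Set
  Stair k x = ∀ v → v < k → 0 ∷ suc v ∷ suc (suc v) ∷ [] ⊆ x

  Stair-++ : ∀ {k x} y → Stair k x → Stair k (x ++ y)
  Stair-++ y stair v v<k = ++⁺ʳ y (stair v v<k)

  Witnesses : Label → List ℕ → Set
  Witnesses zeros x = ⊤
  Witnesses (rising k) x = 0 ∷ suc k ∷ [] ⊆ x × Stair k x
  Witnesses (repeated k) x = 0 ∷ suc k ∷ suc k ∷ [] ⊆ x × Stair k x

  witnesses : ∀ {x s} → Reach x s → Witnesses s x
  witnesses root = tt
  witnesses (grow {x} {z = z} R c) = witnesses-child (child c) (witnesses R)
    where
    witnesses-child : ∀ {s t} → Child s z t → Witnesses s x → Witnesses t (x ++ z ∷ [])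
    witnesses-child zeros-0 _ = tt
    witnesses-child zeros-1 _ = ++⁺ (Reach-0 R) ⊆-refl , λ _ ()
    witnesses-child rising-0 (w , stair) = ++⁺ʳ _ w , Stair-++ _ stair
    witnesses-child rising-top (w , stair) = ++⁺ w ⊆-refl , Stair-++ _ stair
    witnesses-child (rising-new {k}) (w , stair) = ++⁺ (Reach-0 R) ⊆-refl , stair′
      where
      stair′ : Stair (suc k) (x ++ suc (suc k) ∷ [])
      stair′ v v<1+k with m<1+n⇒m<n∨m≡n v<1+k
      ... | inj₁ v<k = ++⁺ʳ _ (stair v v<k)
      ... | inj₂ refl = ++⁺ w ⊆-refl
    witnesses-child repeated-0 (w , stair) = ++⁺ʳ _ w , Stair-++ _ stair
    witnesses-child repeated-top (w , stair) = ++⁺ʳ _ w , Stair-++ _ stair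

  child-avoids : ∀ {x s z t} → Reach x s → (z , t) ∈ children s → Avoids x Patterns → Avoids (x ++ z ∷ []) Patterns
  child-avoids {x} {s} {z} R c (¬0121 ∷ ¬0112 ∷ []) =
    ¬Contains-∷ʳ red≡0121⇔ ¬0121 no-new-0121 ∷ ¬Contains-∷ʳ red≡0112⇔ ¬0112 no-new-0112 ∷ []
    where
    no-new-0121 : ∀ {a b c} → a ∷ b ∷ c ∷ [] ⊆ x → ¬ (a < b × b < c × z ≡ b)
    no-new-0121 abc⊆x (a<b , b<c , refl) = <⇒≱ (<-≤-trans b<c c≤top) (top≤ (child c))
      where
      c≤top = letter≤top R (Any-resp-⊆ abc⊆x (there (there (here refl))))
      top≤ : ∀ {s t} → Child s z t → top s ≤ z
      top≤ zeros-0 = z≤n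
      top≤ zeros-1 = z≤n
      top≤ rising-0 = ⊥-elim (<⇒≱ a<b z≤n)
      top≤ rising-top = ≤-refl
      top≤ rising-new = n≤1+n _
      top≤ repeated-0 = ⊥-elim (<⇒≱ a<b z≤n)
      top≤ repeated-top = ≤-refl
    no-new-0112 : ∀ {a b c} → a ∷ b ∷ c ∷ [] ⊆ x → ¬ (a < b × c ≡ b × b < z)
    no-new-0112 abb⊆x (a<b , refl , b<z) = no-larger (child c) (repeats R abb⊆x a<b)
      where
      no-larger : ∀ {s t} → Child s z t → ¬ Repeats s _
      no-larger repeated-0 _ = <⇒≱ b<z z≤n
      no-larger repeated-top refl = <-irrefl refl b<z

  child-complete : ∀ {x s z} → Reach x s → z ≤ suc (asc x) → Avoids (x ++ z ∷ []) Patterns → ∃[ t ] (z , t) ∈ children s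
  child-complete {x} {s} {z} R z≤ (¬0121 ∷ ¬0112 ∷ []) =
    map₂ child⁺ (admissible s z z≤ (ascents R) (witnesses R) no-0121 no-0112)
    where
    no-0121 : ∀ {a b c} → a ∷ b ∷ c ∷ [] ⊆ x → ¬ (a < b × b < c × z ≡ b)
    no-0121 = ¬Contains-∷ʳ⁻ red≡0121⇔ ¬0121
    no-0112 : ∀ {a b c} → a ∷ b ∷ c ∷ [] ⊆ x → ¬ (a < b × c ≡ b × b < z)
    no-0112 = ¬Contains-∷ʳ⁻ red≡0112⇔ ¬0112
    admissible : ∀ s z → z ≤ suc (asc x) → AscentsOf s (asc x) → Witnesses s x →
                 (∀ {a b c} → a ∷ b ∷ c ∷ [] ⊆ x → ¬ (a < b × b < c × z ≡ b)) →
                 (∀ {a b c} → a ∷ b ∷ c ∷ [] ⊆ x → ¬ (a < b × c ≡ b × b < z)) → ∃[ t ] Child s z t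
    admissible zeros zero _ _ _ _ _ = _ , zeros-0
    admissible zeros (suc zero) _ _ _ _ _ = _ , zeros-1
    admissible zeros (suc (suc _)) (s≤s 1+z≤) a≡0 _ _ _ = ⊥-elim (<⇒≱ (s≤s z≤n) (subst (_ ≤_) a≡0 1+z≤))
    admissible (rising k) zero _ _ _ _ _ = _ , rising-0
    admissible (rising k) (suc v) (s≤s v≤) a≡ (_ , stair) no-0121 _ with <-cmp v k
    ... | tri< v<k _ _ = ⊥-elim (no-0121 (stair v v<k) (s≤s z≤n , ≤-refl , refl))
    ... | tri≈ _ refl _ = _ , rising-top
    ... | tri> _ _ k<v with refl ← ≤-antisym (subst (v ≤_) a≡ v≤) k<v = _ , rising-new
    admissible (repeated k) zero _ _ _ _ _ = _ , repeated-0
    admissible (repeated k) (suc v) _ _ (w , stair) no-0121 no-0112 with <-cmp v k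
    ... | tri< v<k _ _ = ⊥-elim (no-0121 (stair v v<k) (s≤s z≤n , ≤-refl , refl))
    ... | tri≈ _ refl _ = _ , repeated-top
    ... | tri> _ _ k<v = ⊥-elim (no-0112 w (s≤s z≤n , refl , s≤s k<v))

  nodes-repeated : ∀ k d → nodes (repeated k) d ≡ 2 ^ d
  nodes-repeated k zero = refl
  nodes-repeated k (suc d) = cong₂ (λ m n → m + (n + 0)) (nodes-repeated k d) (nodes-repeated k d)

  nodes-rising : ∀ k d → 2 * nodes (rising k) d ≡ (d + 2) * 2 ^ d
  nodes-rising k zero = refl
  nodes-rising k (suc d) = begin
      2 * (nodes (rising k) d + (nodes (repeated k) d + (nodes (rising (suc k)) d + 0)))
    ≡⟨ cong (λ n → 2 * (nodes (rising k) d + (n + (nodes (rising (suc k)) d + 0)))) (nodes-repeated k d) ⟩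
      2 * (nodes (rising k) d + (2 ^ d + (nodes (rising (suc k)) d + 0)))
    ≡⟨ distribute (nodes (rising k) d) (2 ^ d) (nodes (rising (suc k)) d) ⟩
      2 * nodes (rising k) d + 2 * nodes (rising (suc k)) d + 2 * 2 ^ d
    ≡⟨ cong₂ (λ m n → m + n + 2 * 2 ^ d) (nodes-rising k d) (nodes-rising (suc k) d) ⟩
      (d + 2) * 2 ^ d + (d + 2) * 2 ^ d + 2 * 2 ^ d
    ≡⟨ collect d (2 ^ d) ⟩
      (suc d + 2) * 2 ^ suc d
    ∎
    where
    open ≡-Reasoning
    distribute : ∀ a p c → 2 * (a + (p + (c + 0))) ≡ 2 * a + 2 * c + 2 * p
    distribute = solve-∀
    collect : ∀ d p → (d + 2) * p + (d + 2) * p + 2 * p ≡ (suc d + 2) * (2 * p)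
    collect = solve-∀

  open Enumeration children-unique (Avoids-[0] (s≤s (s≤s z≤n) ∷ s≤s (s≤s z≤n) ∷ [])) child-≤ child-avoids child-complete

  aCount-formula : ∀ m → aCount Patterns (suc m) (m * 2 ^ (m ∸ 1) + 1)
  aCount-formula m = subst (aCount Patterns (suc m)) (closed-form (nodes zeros) (nodes (rising 0)) refl
    (λ d → cong (nodes zeros d +_) (+-identityʳ _)) (λ d _ → nodes-rising 0 d) m) (aCount-nodes m)

module Avoiding-0102-0120 where

  Patterns : List (List ℕ)
  Patterns = (0 ∷ 1 ∷ 0 ∷ 2 ∷ []) ∷ (0 ∷ 1 ∷ 2 ∷ 0 ∷ []) ∷ []

  -- zeros: x consists of zeros; rising k: x is weakly increasing and ends with its maximum k + 1;
  -- dropped k: x is a weakly increasing word with maximum k + 1 followed by a word over {k, k + 1}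
  -- beginning with k.
  data Label : Set where
    zeros : Label
    rising dropped : ℕ → Label

  children : Label → List (ℕ × Label)
  children zeros = (0 , zeros) ∷ (1 , rising 0) ∷ []
  children (rising k) = (k , dropped k) ∷ (suc k , rising k) ∷ (suc (suc k) , rising (suc k)) ∷ []
  children (dropped k) = (k , dropped k) ∷ (suc k , dropped k) ∷ []

  data Child : Label → ℕ → Label → Set where
    zeros-0 : Child zeros 0 zeros
    zeros-1 : Child zeros 1 (rising 0)
    rising-drop : ∀ {k} → Child (rising k) k (dropped k)
    rising-top : ∀ {k} → Child (rising k) (suc k) (rising k)
    rising-new : ∀ {k} → Child (rising k) (suc (suc k)) (rising (suc k))
    dropped-low : ∀ {k} → Child (dropped k) k (dropped k)
    dropped-top : ∀ {k} → Child (dropped k) (suc k) (dropped k)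

  child : ∀ {s z t} → (z , t) ∈ children s → Child s z t
  child {zeros} (here refl) = zeros-0
  child {zeros} (there (here refl)) = zeros-1
  child {rising k} (here refl) = rising-drop
  child {rising k} (there (here refl)) = rising-top
  child {rising k} (there (there (here refl))) = rising-new
  child {dropped k} (here refl) = dropped-low
  child {dropped k} (there (here refl)) = dropped-top

  child⁺ : ∀ {s z t} → Child s z t → (z , t) ∈ children s
  child⁺ zeros-0 = here refl
  child⁺ zeros-1 = there (here refl)
  child⁺ rising-drop = here refl
  child⁺ rising-top = there (here refl)
  child⁺ rising-new = there (there (here refl))
  child⁺ dropped-low = here refl
  child⁺ dropped-top = there (here refl)

  children-unique : ∀ s → Unique (map proj₁ (children s))
  children-unique zeros = ((λ ()) ∷ []) ∷ [] ∷ []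
  children-unique (rising k) =
    ((λ e → 1+n≢n (sym e)) ∷ (λ e → <⇒≢ (n≤1+n (suc k)) e) ∷ []) ∷ ((λ e → 1+n≢n (sym e)) ∷ []) ∷ [] ∷ []
  children-unique (dropped k) = ((λ e → 1+n≢n (sym e)) ∷ []) ∷ [] ∷ []

  open GeneratingTree Patterns zeros children

  top : Label → ℕ
  top zeros = 0
  top (rising k) = suc k
  top (dropped k) = suc k

  top-child : ∀ {s z t} → (z , t) ∈ children s → top s ≤ top t × z ≤ top t
  top-child c with child c
  ... | zeros-0 = z≤n , z≤n
  ... | zeros-1 = z≤n , ≤-refl
  ... | rising-drop = ≤-refl , n≤1+n _
  ... | rising-top = ≤-refl , ≤-refl
  ... | rising-new = n≤1+n _ , ≤-refl
  ... | dropped-low = ≤-refl , n≤1+n _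
  ... | dropped-top = ≤-refl , ≤-refl

  letter≤top : ∀ {x s v} → Reach x s → v ∈ x → v ≤ top s
  letter≤top = Reach-letters-≤ top top-child

  EndsWith : Label → List ℕ → Set
  EndsWith zeros x = ∃[ x′ ] x ≡ x′ ++ 0 ∷ []
  EndsWith (rising k) x = ∃[ x′ ] x ≡ x′ ++ suc k ∷ []
  EndsWith (dropped k) x = ⊤

  ends-with : ∀ {x s} → Reach x s → EndsWith s x
  ends-with root = [] , refl
  ends-with (grow {x} _ c) with child c
  ... | zeros-0 = x , refl
  ... | zeros-1 = x , refl
  ... | rising-drop = tt
  ... | rising-top = x , refl
  ... | rising-new = x , refl
  ... | dropped-low = tt
  ... | dropped-top = tt

  AscentsOf : Label → ℕ → Set
  AscentsOf zeros n = n ≡ 0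
  AscentsOf (rising k) n = n ≡ suc k
  AscentsOf (dropped k) n = k ≤ n

  ascents : ∀ {x s} → Reach x s → AscentsOf s (asc x)
  ascents root = refl
  ascents (grow {x} {z = z} R c) = ascents-child (child c) (ends-with R) (ascents R)
    where
    ascents-child : ∀ {s t} → Child s z t → EndsWith s x → AscentsOf s (asc x) → AscentsOf t (asc (x ++ z ∷ []))
    ascents-child zeros-0 (x′ , refl) a≡ = trans (asc-∷ʳ-≤ x′ z≤n) a≡
    ascents-child zeros-1 (x′ , refl) a≡ = trans (asc-∷ʳ-< x′ (s≤s z≤n)) (cong suc a≡)
    ascents-child rising-drop _ a≡ = ≤-trans (≤-trans (n≤1+n _) (≤-reflexive (sym a≡))) (asc-∷ʳ-mono x z)
    ascents-child rising-top (x′ , refl) a≡ = trans (asc-∷ʳ-≤ x′ ≤-refl) a≡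
    ascents-child rising-new (x′ , refl) a≡ = trans (asc-∷ʳ-< x′ ≤-refl) (cong suc a≡)
    ascents-child dropped-low _ a≥ = ≤-trans a≥ (asc-∷ʳ-mono x z)
    ascents-child dropped-top _ a≥ = ≤-trans a≥ (asc-∷ʳ-mono x z)

  child-≤ : ∀ {x s z t} → Reach x s → (z , t) ∈ children s → z ≤ suc (asc x)
  child-≤ {x} R c = bound-child (child c) (ascents R)
    where
    bound-child : ∀ {s z t} → Child s z t → AscentsOf s (asc x) → z ≤ suc (asc x)
    bound-child zeros-0 _ = z≤n
    bound-child zeros-1 _ = s≤s z≤n
    bound-child rising-drop a≡ = ≤-trans (≤-trans (n≤1+n _) (n≤1+n _)) (s≤s (≤-reflexive (sym a≡)))
    bound-child rising-top a≡ = ≤-trans (n≤1+n _) (s≤s (≤-reflexive (sym a≡)))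
    bound-child rising-new a≡ = s≤s (≤-reflexive (sym a≡))
    bound-child dropped-low a≥ = ≤-trans a≥ (n≤1+n _)
    bound-child dropped-top a≥ = s≤s a≥

  Sorted : List ℕ → Set
  Sorted x = ∀ {a b} → a ∷ b ∷ [] ⊆ x → a ≤ b

  SortedUnlessDropped : Label → List ℕ → Set
  SortedUnlessDropped (dropped _) x = ⊤
  SortedUnlessDropped _ x = Sorted x

  sorted : ∀ {x s} → Reach x s → SortedUnlessDropped s x
  sorted root (_ ∷ ())
  sorted root (_ ∷ʳ ())
  sorted (grow {x} {s} {z} R c) = sorted-child (child c) (letter≤top R) (sorted R)
    where
    sorted-∷ʳ : Sorted x → (∀ {v} → v ∈ x → v ≤ z) → Sorted (x ++ z ∷ [])
    sorted-∷ʳ sorted-x x≤z ab⊆xz with ⊆-∷ʳ⁻ (_ ∷ []) x z ab⊆xz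
    ... | inj₁ ab⊆x = sorted-x ab⊆x
    ... | inj₂ (a⊆x , refl) = x≤z (Any-resp-⊆ a⊆x (here refl))
    sorted-child : ∀ {s t} → Child s z t → (∀ {v} → v ∈ x → v ≤ top s) → SortedUnlessDropped s x → SortedUnlessDropped t (x ++ z ∷ [])
    sorted-child zeros-0 ≤top sorted-x = sorted-∷ʳ sorted-x ≤top
    sorted-child zeros-1 ≤top sorted-x = sorted-∷ʳ sorted-x (λ v∈x → ≤-trans (≤top v∈x) z≤n)
    sorted-child rising-drop _ _ = tt
    sorted-child rising-top ≤top sorted-x = sorted-∷ʳ sorted-x ≤top
    sorted-child rising-new ≤top sorted-x = sorted-∷ʳ sorted-x (λ v∈x → ≤-trans (≤top v∈x) (n≤1+n _))
    sorted-child dropped-low _ _ = tt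
    sorted-child dropped-top _ _ = tt

  Returns : Label → ℕ → Set
  Returns (dropped k) b = b ≡ suc k
  Returns _ _ = ⊥

  returns : ∀ {x s a b} → Reach x s → a ∷ b ∷ a ∷ [] ⊆ x → a < b → Returns s b
  returns {s = zeros} R aba⊆x a<b = <⇒≱ a<b (sorted R (∷ˡ⁻ aba⊆x))
  returns {s = rising _} R aba⊆x a<b = <⇒≱ a<b (sorted R (∷ˡ⁻ aba⊆x))
  returns {s = dropped _} {a} {b} (grow {x} {z = z} R c) aba⊆x a<b with ⊆-∷ʳ⁻ (a ∷ b ∷ []) x z aba⊆x
  ... | inj₁ aba⊆x′ = returns-old (child c) (returns R aba⊆x′ a<b)
    where
    returns-old : ∀ {s k} → Child s z (dropped k) → Returns s b → b ≡ suc k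
    returns-old dropped-low b≡ = b≡
    returns-old dropped-top b≡ = b≡
  ... | inj₂ (ab⊆x , refl) = returns-new (child c) (letter≤top R (Any-resp-⊆ ab⊆x (there (here refl))))
    where
    returns-new : ∀ {s k} → Child s a (dropped k) → b ≤ top s → b ≡ suc k
    returns-new rising-drop b≤ = ≤-antisym b≤ a<b
    returns-new dropped-low b≤ = ≤-antisym b≤ a<b
    returns-new dropped-top b≤ = ⊥-elim (<⇒≱ a<b b≤)

  Stair : ℕ → List ℕ → Set
  Stair k x = ∀ v → v < k → v ∷ suc v ∷ suc (suc v) ∷ [] ⊆ x

  Stair-++ : ∀ {k x} y → Stair k x → Stair k (x ++ y)
  Stair-++ y stair v v<k = ++⁺ʳ y (stair v v<k)

  Witnesses : Label → List ℕ → Set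
  Witnesses zeros x = ⊤
  Witnesses (rising k) x = k ∷ suc k ∷ [] ⊆ x × Stair k x
  Witnesses (dropped k) x = k ∷ suc k ∷ k ∷ [] ⊆ x × Stair k x

  witnesses : ∀ {x s} → Reach x s → Witnesses s x
  witnesses root = tt
  witnesses (grow {x} {z = z} R c) = witnesses-child (child c) (witnesses R)
    where
    witnesses-child : ∀ {s t} → Child s z t → Witnesses s x → Witnesses t (x ++ z ∷ [])
    witnesses-child zeros-0 _ = tt
    witnesses-child zeros-1 _ = ++⁺ (Reach-0 R) ⊆-refl , λ _ ()
    witnesses-child rising-drop (w , stair) = ++⁺ w ⊆-refl , Stair-++ _ stair
    witnesses-child rising-top (w , stair) = ++⁺ʳ _ w , Stair-++ _ stair
    witnesses-child (rising-new {k}) (w , stair) = ++⁺ (∷ˡ⁻ w) ⊆-refl , stair′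
      where
      stair′ : Stair (suc k) (x ++ suc (suc k) ∷ [])
      stair′ v v<1+k with m<1+n⇒m<n∨m≡n v<1+k
      ... | inj₁ v<k = ++⁺ʳ _ (stair v v<k)
      ... | inj₂ refl = ++⁺ w ⊆-refl
    witnesses-child dropped-low (w , stair) = ++⁺ʳ _ w , Stair-++ _ stair
    witnesses-child dropped-top (w , stair) = ++⁺ʳ _ w , Stair-++ _ stair

  child-avoids : ∀ {x s z t} → Reach x s → (z , t) ∈ children s → Avoids x Patterns → Avoids (x ++ z ∷ []) Patterns
  child-avoids {x} {s} {z} R c (¬0102 ∷ ¬0120 ∷ []) =
    ¬Contains-∷ʳ red≡0102⇔ ¬0102 no-new-0102 ∷ ¬Contains-∷ʳ red≡0120⇔ ¬0120 no-new-0120 ∷ []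
    where
    no-new-0102 : ∀ {a b c} → a ∷ b ∷ c ∷ [] ⊆ x → ¬ (a < b × c ≡ a × b < z)
    no-new-0102 aba⊆x (a<b , refl , b<z) = no-larger (child c) (returns R aba⊆x a<b)
      where
      no-larger : ∀ {s t} → Child s z t → ¬ Returns s _
      no-larger dropped-low refl = <⇒≱ b<z (n≤1+n _)
      no-larger dropped-top refl = <-irrefl refl b<z
    no-new-0120 : ∀ {a b c} → a ∷ b ∷ c ∷ [] ⊆ x → ¬ (a < b × b < c × z ≡ a)
    no-new-0120 abc⊆x (a<b , b<c , refl) = <⇒≱ (<-≤-trans (s≤s a<b) b<c) (≤-trans c≤top (top≤ (child c)))
      where
      c≤top = letter≤top R (Any-resp-⊆ abc⊆x (there (there (here refl))))
      top≤ : ∀ {s t} → Child s z t → top s ≤ suc z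
      top≤ zeros-0 = z≤n
      top≤ zeros-1 = z≤n
      top≤ rising-drop = ≤-refl
      top≤ rising-top = n≤1+n _
      top≤ rising-new = ≤-trans (n≤1+n _) (n≤1+n _)
      top≤ dropped-low = ≤-refl
      top≤ dropped-top = n≤1+n _

  child-complete : ∀ {x s z} → Reach x s → z ≤ suc (asc x) → Avoids (x ++ z ∷ []) Patterns → ∃[ t ] (z , t) ∈ children s
  child-complete {x} {s} {z} R z≤ (¬0102 ∷ ¬0120 ∷ []) =
    map₂ child⁺ (admissible s z z≤ (ascents R) (witnesses R) no-0102 no-0120)
    where
    no-0102 : ∀ {a b c} → a ∷ b ∷ c ∷ [] ⊆ x → ¬ (a < b × c ≡ a × b < z)
    no-0102 = ¬Contains-∷ʳ⁻ red≡0102⇔ ¬0102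
    no-0120 : ∀ {a b c} → a ∷ b ∷ c ∷ [] ⊆ x → ¬ (a < b × b < c × z ≡ a)
    no-0120 = ¬Contains-∷ʳ⁻ red≡0120⇔ ¬0120
    admissible : ∀ s z → z ≤ suc (asc x) → AscentsOf s (asc x) → Witnesses s x →
                 (∀ {a b c} → a ∷ b ∷ c ∷ [] ⊆ x → ¬ (a < b × c ≡ a × b < z)) →
                 (∀ {a b c} → a ∷ b ∷ c ∷ [] ⊆ x → ¬ (a < b × b < c × z ≡ a)) → ∃[ t ] Child s z t
    admissible zeros zero _ _ _ _ _ = _ , zeros-0
    admissible zeros (suc zero) _ _ _ _ _ = _ , zeros-1
    admissible zeros (suc (suc _)) (s≤s 1+z≤) a≡0 _ _ _ = ⊥-elim (<⇒≱ (s≤s z≤n) (subst (_ ≤_) a≡0 1+z≤))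
    admissible (rising k) v v≤ a≡ (_ , stair) _ no-0120 with <-cmp v k
    ... | tri< v<k _ _ = ⊥-elim (no-0120 (stair v v<k) (n<1+n v , n<1+n _ , refl))
    ... | tri≈ _ refl _ = _ , rising-drop
    ... | tri> _ _ k<v with m≤n⇒m<n∨m≡n (≤-trans v≤ (s≤s (≤-reflexive a≡)))
    ...   | inj₂ refl = _ , rising-new
    ...   | inj₁ v<2+k with refl ← ≤-antisym (≤-pred v<2+k) k<v = _ , rising-top
    admissible (dropped k) v _ _ (w , stair) no-0102 no-0120 with <-cmp v k
    ... | tri< v<k _ _ = ⊥-elim (no-0120 (stair v v<k) (n<1+n v , n<1+n _ , refl))
    ... | tri≈ _ refl _ = _ , dropped-low
    ... | tri> _ _ k<v with <-cmp v (suc k)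
    ...   | tri< v<1+k _ _ = ⊥-elim (<⇒≱ k<v (≤-pred v<1+k))
    ...   | tri≈ _ refl _ = _ , dropped-top
    ...   | tri> _ _ 1+k<v = ⊥-elim (no-0102 w (n<1+n k , refl , 1+k<v))

  nodes-dropped : ∀ k d → nodes (dropped k) d ≡ 2 ^ d
  nodes-dropped k zero = refl
  nodes-dropped k (suc d) = cong₂ (λ m n → m + (n + 0)) (nodes-dropped k d) (nodes-dropped k d)

  nodes-rising : ∀ k d → 2 * nodes (rising k) d ≡ (d + 2) * 2 ^ d
  nodes-rising k zero = refl
  nodes-rising k (suc d) = begin
      2 * (nodes (dropped k) d + (nodes (rising k) d + (nodes (rising (suc k)) d + 0)))
    ≡⟨ cong (λ n → 2 * (n + (nodes (rising k) d + (nodes (rising (suc k)) d + 0)))) (nodes-dropped k d) ⟩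
      2 * (2 ^ d + (nodes (rising k) d + (nodes (rising (suc k)) d + 0)))
    ≡⟨ distribute (2 ^ d) (nodes (rising k) d) (nodes (rising (suc k)) d) ⟩
      2 * nodes (rising k) d + 2 * nodes (rising (suc k)) d + 2 * 2 ^ d
    ≡⟨ cong₂ (λ m n → m + n + 2 * 2 ^ d) (nodes-rising k d) (nodes-rising (suc k) d) ⟩
      (d + 2) * 2 ^ d + (d + 2) * 2 ^ d + 2 * 2 ^ d
    ≡⟨ collect d (2 ^ d) ⟩
      (suc d + 2) * 2 ^ suc d
    ∎
    where
    open ≡-Reasoning
    distribute : ∀ p a c → 2 * (p + (a + (c + 0))) ≡ 2 * a + 2 * c + 2 * p
    distribute = solve-∀
    collect : ∀ d p → (d + 2) * p + (d + 2) * p + 2 * p ≡ (suc d + 2) * (2 * p)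
    collect = solve-∀

  open Enumeration children-unique (Avoids-[0] (s≤s (s≤s z≤n) ∷ s≤s (s≤s z≤n) ∷ [])) child-≤ child-avoids child-complete

  aCount-formula : ∀ m → aCount Patterns (suc m) (m * 2 ^ (m ∸ 1) + 1)
  aCount-formula m = subst (aCount Patterns (suc m)) (closed-form (nodes zeros) (nodes (rising 0)) refl
    (λ d → cong (nodes zeros d +_) (+-identityʳ _)) (λ d _ → nodes-rising 0 d) m) (aCount-nodes m)

theorem3p2 : (n : ℕ) → 1 ≤ n →
    aCount ((0 ∷ 1 ∷ 0 ∷ 1 ∷ []) ∷ (0 ∷ 1 ∷ 1 ∷ 2 ∷ []) ∷ []) n ((n ∸ 1) * 2 ^ (n ∸ 2) + 1)
    × aCount ((0 ∷ 1 ∷ 0 ∷ 2 ∷ []) ∷ (0 ∷ 1 ∷ 1 ∷ 2 ∷ []) ∷ []) n ((n ∸ 1) * 2 ^ (n ∸ 2) + 1)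
    × aCount ((0 ∷ 1 ∷ 2 ∷ 1 ∷ []) ∷ (0 ∷ 1 ∷ 1 ∷ 2 ∷ []) ∷ []) n ((n ∸ 1) * 2 ^ (n ∸ 2) + 1)
    × aCount ((0 ∷ 1 ∷ 0 ∷ 2 ∷ []) ∷ (0 ∷ 1 ∷ 2 ∷ 0 ∷ []) ∷ []) n ((n ∸ 1) * 2 ^ (n ∸ 2) + 1)
theorem3p2 zero ()
theorem3p2 (suc m) _ =
    Avoiding-0101-0112.aCount-formula m
  , Avoiding-0102-0112.aCount-formula m
  , Avoiding-0121-0112.aCount-formula m
  , Avoiding-0102-0120.aCount-formula m
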